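{- For all integers $n\ge3$, $\operatorname{th_{mdim}}(C_n)=2\sqrt n\,(1\pm o(1))$ and $\operatorname{th_{mdim}}(P_n)=2\sqrt n\,(1\pm o(1))$ as $n\to\infty$.
   Context: $C_n$ and $P_n$ are the cycle and path on $n$ vertices. $\operatorname{dist}(u,v)$ is the shortest-path distance. For an edge $e=\{u,w\}$ and vertex $v$, $\operatorname{dist}(e,v)=\min(\operatorname{dist}(u,v),\operatorname{dist}(w,v))$. For a nonnegative integer $r$ and $a\in V(G)\cup E(G)$, $\operatorname{dist}_r(a,v)=\min(\operatorname{dist}(a,v),r+1)$. A set $S\subseteq V(G)$ is a distance-$r$ mixed resolving set if for all distinct $a,b\in V(G)\cup E(G)$ there is $v\in S$ with $\operatorname{dist}_r(v,a)\ne\operatorname{dist}_r(v,b)$. $\operatorname{mdim}_r(G)$ is the minimum size of such a set and $\operatorname{th_{mdim}}(G)=\min_{r\ge0}(r+\operatorname{mdim}_r(G))$ over nonnegative integers $r$. -}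

module Defs where

open import Data.Nat using (ℕ; zero; suc; _+_; _*_; _∸_; _≤_; _⊔_; _⊓_)
open import Data.Bool using (Bool; true; false; _∨_; _∧_; if_then_else_)
open import Data.Fin using (Fin; toℕ)
open import Data.Fin.Subset using (Subset; _∈_; ∣_∣)
open import Data.Fin.Properties using (any?)
open import Data.Product using (Σ; _×_; _,_; ∃)
open import Data.Sum using (_⊎_; inj₁; inj₂)
open import Relation.Nullary using (¬_; Dec; yes; no)
open import Relation.Nullary.Decidable using (⌊_⌋)
open import Relation.Binary.PropositionalEquality using (_≡_; _≢_)
import Data.Nat as ℕ
import Data.Fin as F

-- A simple graph on vertex set Fin n, given by a (symmetric, irreflexive) boolean adjacency.
Graph : ℕ → Set
Graph n = Fin n → Fin n → Bool

absDiff : ℕ → ℕ → ℕ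
absDiff a b = (a ∸ b) ⊔ (b ∸ a)

pathGraph : (n : ℕ) → Graph n
pathGraph n u w = ⌊ absDiff (toℕ u) (toℕ w) ℕ.≟ 1 ⌋

cycleGraph : (n : ℕ) → Graph n
cycleGraph n u w = ⌊ absDiff (toℕ u) (toℕ w) ℕ.≟ 1 ⌋ ∨ ⌊ absDiff (toℕ u) (toℕ w) ℕ.≟ (n ∸ 1) ⌋

reach : {n : ℕ} → Graph n → ℕ → Fin n → Fin n → Bool
reach G zero u v = ⌊ u F.≟ v ⌋
reach G (suc k) u v = reach G k u v ∨ ⌊ any? (λ w → reach G k u w ∧ G w v Data.Bool.≟ true) ⌋

-- Shortest-path distance: least k with reach k (searching k = 0,1,...,n; any
-- shortest path in a graph on n vertices has length < n).
distSearch : {n : ℕ} → Graph n → Fin n → Fin n → ℕ → ℕ → ℕ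
distSearch G u v k zero = k
distSearch G u v k (suc fuel) = if reach G k u v then k else distSearch G u v (suc k) fuel

dist : {n : ℕ} → Graph n → Fin n → Fin n → ℕ
dist {n} G u v = distSearch G u v 0 n

-- Elements of V(G) ∪ E(G): a vertex, or an ordered pair (u , w) representing
-- the edge {u , w}, valid only when toℕ u < toℕ w and u ~ w.
Elem : ℕ → Set
Elem n = Fin n ⊎ (Fin n × Fin n)

ValidElem : {n : ℕ} → Graph n → Elem n → Set
ValidElem G (inj₁ v) = Data.Unit.⊤
  where import Data.Unit
ValidElem G (inj₂ (u , w)) = (toℕ u ℕ.< toℕ w) × (G u w ≡ true)

distE : {n : ℕ} → Graph n → Elem n → Fin n → ℕ
distE G (inj₁ x) v = dist G x v
distE G (inj₂ (u , w)) v = dist G u v ⊓ dist G w v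

distR : {n : ℕ} → Graph n → ℕ → Elem n → Fin n → ℕ
distR G r a v = distE G a v ⊓ suc r

IsMixedResolving : {n : ℕ} → Graph n → ℕ → Subset n → Set
IsMixedResolving {n} G r S =
  (a b : Elem n) → ValidElem G a → ValidElem G b → a ≢ b →
  ∃ λ v → (v ∈ S) × (distR G r a v ≢ distR G r b v)

-- t = th_mdim(G) = min over r ≥ 0 of (r + mdim_r(G)),
-- i.e. t = min { r + |S| : r ∈ ℕ, S distance-r mixed resolving }.
IsThMdim : {n : ℕ} → Graph n → ℕ → Set
IsThMdim {n} G t =
  (Σ ℕ λ r → Σ (Subset n) λ S → IsMixedResolving G r S × (r + ∣ S ∣ ≡ t)) ×
  ((r : ℕ) (S : Subset n) → IsMixedResolving G r S → t ≤ r + ∣ S ∣)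

-- t = 2√n (1 ± 1/k), squared (all quantities nonnegative, k ≥ 1):
-- (1 - 1/k)·2√n ≤ t ≤ (1 + 1/k)·2√n  ⟺  4n(k-1)² ≤ k²t²  ∧  k²t² ≤ 4n(k+1)².
WithinFactor : ℕ → ℕ → ℕ → Set
WithinFactor k n t =
  (4 * n * ((k ∸ 1) * (k ∸ 1)) ≤ (k * k) * (t * t)) ×
  ((k * k) * (t * t) ≤ 4 * n * ((k + 1) * (k + 1)))

{-# OPTIONS --safe #-}
-- If S resolves at distance r, the vertex x and the edge {x, x + 1} have the same
-- truncated distance to every vertex outside the window (x, x + r + 1], so each of the
-- ⌊(n - 1)/(r + 1)⌋ disjoint windows of r + 1 vertices contains a landmark.  Hence
-- n ≤ (|S| + 1)(r + 1) ≤ ((r + |S| + 2)/2)², i.e. th_mdim ≥ 2√n - 2.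
-- Upper bound.  For r = ⌊√n⌋ the multiples of r together with the last vertex resolve at
-- distance r, with r + |S| ≤ 2√n + 4.  Key each element by its lower endpoint.  The landmark less
-- than r below the smaller key sees the other element strictly farther away, and the landmark at
-- most r above a key separates the vertex from the edge with that key.  On the cycle the first
-- landmark can fail only when the larger key lies within r of it the other way round, and then
-- the landmark below the larger key works instead.

module Submission where

open import Defs
open import Data.Bool using (true; false; _∨_; _∧_)
import Data.Bool as Bool
open import Data.Empty using (⊥-elim)
open import Data.Fin using (Fin; toℕ; fromℕ<)
import Data.Fin as Fin
open import Data.Fin.Properties using (any?; all?; toℕ<n; toℕ≤pred[n]; toℕ-injective; toℕ-fromℕ<)
open import Data.Fin.Subset using (Subset; _∈_; ∣_∣; ⁅_⁆; _∪_; ⊥)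
open import Data.Fin.Subset.Properties using (x∈⁅x⁆; x∈p∪q⁺; ∣⁅x⁆∣≡1; ∣⊥∣≡0; _∈?_; anySubset?)
open import Data.Nat
open import Data.Nat.DivMod using (_/_; _%_; m≡m%n+[m/n]*n; m%n<n; m/n*n≤m; m*n/n≡m; /-monoˡ-≤)
open import Data.Nat.Properties
open import Data.Nat.Tactic.RingSolver using (solve-∀)
open import Data.Product using (Σ; _×_; _,_; ∃; ∃₂; proj₁; proj₂)
import Data.Product.Properties as Product
open import Data.Sum using (_⊎_; inj₁; inj₂)
import Data.Sum.Properties as Sum
open import Data.Unit using (tt)
open import Data.Vec.Base using (_∷_; []; here; there)
open import Relation.Binary.PropositionalEquality
open import Relation.Nullary using (¬_; Dec; yes; no)
open import Relation.Nullary.Decidable using (⌊_⌋; _×-dec_; _→-dec_; ¬?; map′)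

⌊⌋≡true⇒ : {P : Set} (d : Dec P) → ⌊ d ⌋ ≡ true → P
⌊⌋≡true⇒ (yes p) _ = p

⇒⌊⌋≡true : {P : Set} (d : Dec P) → P → ⌊ d ⌋ ≡ true
⇒⌊⌋≡true (yes _) _ = refl
⇒⌊⌋≡true (no ¬p) p = ⊥-elim (¬p p)

∨≡true⇒ : ∀ a b → a ∨ b ≡ true → a ≡ true ⊎ b ≡ true
∨≡true⇒ true  _ _ = inj₁ refl
∨≡true⇒ false _ e = inj₂ e

∨≡trueˡ : ∀ {a} b → a ≡ true → a ∨ b ≡ true
∨≡trueˡ _ refl = refl

∨≡trueʳ : ∀ a {b} → b ≡ true → a ∨ b ≡ true
∨≡trueʳ true  _ = refl
∨≡trueʳ false e = e

∧≡true⇒ : ∀ a b → a ∧ b ≡ true → a ≡ true × b ≡ true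
∧≡true⇒ true true _ = refl , refl

∣a-1+a∣≡1 : ∀ a → ∣ a - suc a ∣ ≡ 1
∣a-1+a∣≡1 zero    = refl
∣a-1+a∣≡1 (suc a) = ∣a-1+a∣≡1 a

∣1+a-a∣≡1 : ∀ a → ∣ suc a - a ∣ ≡ 1
∣1+a-a∣≡1 a = trans (∣-∣-comm (suc a) a) (∣a-1+a∣≡1 a)

∣-∣-unit-step : ∀ a b c → ∣ b - c ∣ ≡ 1 → ∣ a - c ∣ ≤ suc ∣ a - b ∣
∣-∣-unit-step a b c bc = begin
  ∣ a - c ∣             ≤⟨ ∣-∣-triangle a b c ⟩
  ∣ a - b ∣ + ∣ b - c ∣ ≡⟨ cong (∣ a - b ∣ +_) bc ⟩
  ∣ a - b ∣ + 1         ≡⟨ +-comm ∣ a - b ∣ 1 ⟩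
  suc ∣ a - b ∣         ∎
  where open ≤-Reasoning

∣-∣<n : ∀ {n a b} → a < n → b < n → ∣ a - b ∣ < n
∣-∣<n {a = a} {b} a<n b<n = ≤-<-trans (∣m-n∣≤m⊔n a b) (⊔-lub a<n b<n)

step-toward : ∀ a b d → ∣ a - b ∣ ≡ suc d →
  ∃ λ c → ∣ a - c ∣ ≡ d × ∣ c - b ∣ ≡ 1 × c ≤ a ⊔ b
step-toward zero    (suc b) d refl = b , refl , ∣a-1+a∣≡1 b , n≤1+n b
step-toward (suc a) zero    d refl = 1 , ∣-∣-identityʳ a , refl , s≤s z≤n
step-toward (suc a) (suc b) d ab≡1+d with step-toward a b d ab≡1+d
... | c , ac≡d , cb≡1 , c≤a⊔b = suc c , ac≡d , cb≡1 , s≤s c≤a⊔b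

[1+m]∸n≤1+[m∸n] : ∀ m n → suc m ∸ n ≤ suc (m ∸ n)
[1+m]∸n≤1+[m∸n] m       zero    = ≤-refl
[1+m]∸n≤1+[m∸n] zero    (suc n) = subst (_≤ 1) (sym (0∸n≡0 n)) z≤n
[1+m]∸n≤1+[m∸n] (suc m) (suc n) = [1+m]∸n≤1+[m∸n] m n

∣a-1+b∣≡1+∣a-b∣ : ∀ {a b} → a ≤ b → ∣ a - suc b ∣ ≡ suc ∣ a - b ∣
∣a-1+b∣≡1+∣a-b∣ {a} {b} a≤b = begin
  ∣ a - suc b ∣ ≡⟨ m≤n⇒∣m-n∣≡n∸m (m≤n⇒m≤1+n a≤b) ⟩
  suc b ∸ a     ≡⟨ +-∸-assoc 1 a≤b ⟩
  suc (b ∸ a)   ≡⟨ cong suc (m≤n⇒∣m-n∣≡n∸m a≤b) ⟨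
  suc ∣ a - b ∣ ∎
  where open ≡-Reasoning

m∸n≡o⇒m≡o×n≡0 : ∀ {o m n} → m ≤ o → n ≤ o → m ∸ n ≡ o → m ≡ o × n ≡ 0
m∸n≡o⇒m≡o×n≡0 {n = zero}              _     _     e    = e , refl
m∸n≡o⇒m≡o×n≡0 {m = zero}  {n = suc n} _     ()    refl
m∸n≡o⇒m≡o×n≡0 {m = suc m} {n = suc n} 1+m≤o _     refl =
  ⊥-elim (<-irrefl refl (≤-<-trans (m∸n≤m m n) 1+m≤o))

∣a-b∣≡m⇒endpoints : ∀ {m a b} → a ≤ m → b ≤ m → ∣ a - b ∣ ≡ m →
  (a ≡ 0 × b ≡ m) ⊎ (a ≡ m × b ≡ 0)
∣a-b∣≡m⇒endpoints {a = a} {b} a≤m b≤m ab≡m with ∣m-n∣≡[m∸n]∨[n∸m] a b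
... | inj₁ e = inj₂ (m∸n≡o⇒m≡o×n≡0 a≤m b≤m (trans (sym e) ab≡m))
... | inj₂ e with m∸n≡o⇒m≡o×n≡0 b≤m a≤m (trans (sym e) ab≡m)
...   | b≡m , a≡0 = inj₁ (a≡0 , b≡m)

[1+m]∸[m∸a]≡1+a : ∀ {m a} → a ≤ m → suc m ∸ (m ∸ a) ≡ suc a
[1+m]∸[m∸a]≡1+a {m} {a} a≤m = trans (+-∸-assoc 1 (m∸n≤m m a)) (cong suc (m∸[m∸n]≡n a≤m))

∣a+d-a∣≡d : ∀ a d → ∣ a + d - a ∣ ≡ d
∣a+d-a∣≡d a d = trans (∣-∣-comm (a + d) a) (∣m-m+n∣≡n a d)

1+[a+d+e]≡a+[d+1+e] : ∀ a d e → suc (a + d + e) ≡ a + (d + suc e)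
1+[a+d+e]≡a+[d+1+e] = solve-∀

⊓-pair : ∀ {a b c d} → a ≤ b → d ≤ c → (a ⊓ c) ⊓ (b ⊓ d) ≡ a ⊓ d
⊓-pair {a} {b} {c} {d} a≤b d≤c = ≤-antisym
  (⊓-glb (≤-trans (m⊓n≤m _ _) (m⊓n≤m _ _)) (≤-trans (m⊓n≤n _ _) (m⊓n≤n _ _)))
  (⊓-glb (⊓-mono-≤ ≤-refl d≤c) (⊓-mono-≤ a≤b ≤-refl))

⊓-absorb : ∀ {x a c} → c ≤ a → (x ⊓ a) ⊓ c ≡ x ⊓ c
⊓-absorb {x} {a} {c} c≤a = trans (⊓-assoc x a c) (cong (x ⊓_) (m≥n⇒m⊓n≡n c≤a))

-- Shortest-path distances in paths and cycles

module _ {n} (G : Graph n) (u : Fin n) (δ : Fin n → ℕ)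
  (δ≡0⇒source : ∀ v → δ v ≡ 0 → u ≡ v) (δ-source : δ u ≡ 0)
  (δ-unit-step : ∀ w v → G w v ≡ true → δ v ≤ suc (δ w))
  (δ-predecessor : ∀ v d → δ v ≡ suc d → ∃ λ w → G w v ≡ true × δ w ≤ d)
  where

  reach⇒δ≤ : ∀ k v → reach G k u v ≡ true → δ v ≤ k
  reach⇒δ≤ zero v e with ⌊⌋≡true⇒ (u Fin.≟ v) e
  ... | refl = ≤-reflexive δ-source
  reach⇒δ≤ (suc k) v e with ∨≡true⇒ (reach G k u v) _ e
  ... | inj₁ e′ = m≤n⇒m≤1+n (reach⇒δ≤ k v e′)
  ... | inj₂ e′ with ⌊⌋≡true⇒ (any? (λ w → reach G k u w ∧ G w v Bool.≟ true)) e′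
  ...   | w , e″ with ∧≡true⇒ (reach G k u w) (G w v) e″
  ...     | kw , wv = ≤-trans (δ-unit-step w v wv) (s≤s (reach⇒δ≤ k w kw))

  δ≤⇒reach : ∀ k v → δ v ≤ k → reach G k u v ≡ true
  δ≤⇒reach zero v δv≤0 = ⇒⌊⌋≡true (u Fin.≟ v) (δ≡0⇒source v (n≤0⇒n≡0 δv≤0))
  δ≤⇒reach (suc k) v δv≤1+k with m≤n⇒m<n∨m≡n δv≤1+k
  ... | inj₁ δv≤k = ∨≡trueˡ _ (δ≤⇒reach k v (s≤s⁻¹ δv≤k))
  ... | inj₂ δv≡1+k with δ-predecessor v k δv≡1+k
  ... | w , wv , δw≤k = ∨≡trueʳ (reach G k u v)
    (⇒⌊⌋≡true (any? (λ w → reach G k u w ∧ G w v Bool.≟ true))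
      (w , cong₂ _∧_ (δ≤⇒reach k w δw≤k) wv))

  distSearch≡δ : ∀ k fuel v → k ≤ δ v → δ v ≤ k + fuel → distSearch G u v k fuel ≡ δ v
  distSearch≡δ k zero v k≤δv δv≤k = ≤-antisym k≤δv (subst (δ v ≤_) (+-identityʳ k) δv≤k)
  distSearch≡δ k (suc fuel) v k≤δv δv≤k+fuel with reach G k u v in kv
  ... | true  = ≤-antisym k≤δv (reach⇒δ≤ k v kv)
  ... | false = distSearch≡δ (suc k) fuel v k<δv (subst (δ v ≤_) (+-suc k fuel) δv≤k+fuel)
    where
    k<δv : k < δ v
    k<δv with m≤n⇒m<n∨m≡n k≤δv
    ... | inj₁ k<δv = k<δv
    ... | inj₂ k≡δv with trans (sym (δ≤⇒reach k v (≤-reflexive (sym k≡δv)))) kv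
    ... | ()

  dist≡δ : ∀ v → δ v ≤ n → dist G u v ≡ δ v
  dist≡δ v δv≤n = distSearch≡δ 0 n v z≤n δv≤n

absDiff≡∣-∣ : ∀ a b → absDiff a b ≡ ∣ a - b ∣
absDiff≡∣-∣ zero    zero    = refl
absDiff≡∣-∣ zero    (suc b) = refl
absDiff≡∣-∣ (suc a) zero    = refl
absDiff≡∣-∣ (suc a) (suc b) = absDiff≡∣-∣ a b

pathGraph-adjacent : ∀ {n} (w v : Fin n) → pathGraph n w v ≡ true → ∣ toℕ w - toℕ v ∣ ≡ 1
pathGraph-adjacent w v e =
  trans (sym (absDiff≡∣-∣ (toℕ w) (toℕ v))) (⌊⌋≡true⇒ (absDiff (toℕ w) (toℕ v) ≟ 1) e)

adjacent-pathGraph : ∀ {n} (w v : Fin n) → ∣ toℕ w - toℕ v ∣ ≡ 1 → pathGraph n w v ≡ true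
adjacent-pathGraph w v e =
  ⇒⌊⌋≡true (absDiff (toℕ w) (toℕ v) ≟ 1) (trans (absDiff≡∣-∣ (toℕ w) (toℕ v)) e)

dist-pathGraph : ∀ n (u v : Fin n) → dist (pathGraph n) u v ≡ ∣ toℕ u - toℕ v ∣
dist-pathGraph n u v =
  dist≡δ (pathGraph n) u δ
    (λ v δv≡0 → toℕ-injective (∣m-n∣≡0⇒m≡n δv≡0))
    (∣n-n∣≡0 (toℕ u))
    (λ w v wv → ∣-∣-unit-step (toℕ u) (toℕ w) (toℕ v) (pathGraph-adjacent w v wv))
    predecessor
    v (<⇒≤ (∣-∣<n (toℕ<n u) (toℕ<n v)))
  where
  δ : Fin n → ℕ
  δ x = ∣ toℕ u - toℕ x ∣

  predecessor : ∀ v d → δ v ≡ suc d → ∃ λ w → pathGraph n w v ≡ true × δ w ≤ d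
  predecessor v d δv≡1+d with step-toward (toℕ u) (toℕ v) d δv≡1+d
  ... | c , uc≡d , cv≡1 , c≤u⊔v = w , adjacent-pathGraph w v w-v , ≤-reflexive u-w
    where
    c<n : c < n
    c<n = ≤-<-trans c≤u⊔v (⊔-lub (toℕ<n u) (toℕ<n v))
    w : Fin n
    w = fromℕ< c<n
    w-v : ∣ toℕ w - toℕ v ∣ ≡ 1
    w-v = trans (cong ∣_- toℕ v ∣ (toℕ-fromℕ< c<n)) cv≡1
    u-w : ∣ toℕ u - toℕ w ∣ ≡ d
    u-w = trans (cong ∣ toℕ u -_∣ (toℕ-fromℕ< c<n)) uc≡d

cycleDist : ℕ → ℕ → ℕ → ℕ
cycleDist n a b = ∣ a - b ∣ ⊓ (n ∸ ∣ a - b ∣)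

cycleDist-unit-step : ∀ n a b c → ∣ b - c ∣ ≡ 1 → cycleDist n a c ≤ suc (cycleDist n a b)
cycleDist-unit-step n a b c bc≡1 = ⊓-mono-≤ (∣-∣-unit-step a b c bc≡1) n∸ac≤1+n∸ab
  where
  ab≤1+ac : ∣ a - b ∣ ≤ suc ∣ a - c ∣
  ab≤1+ac = ∣-∣-unit-step a c b (trans (∣-∣-comm c b) bc≡1)
  n∸ac≤1+n∸ab : n ∸ ∣ a - c ∣ ≤ suc (n ∸ ∣ a - b ∣)
  n∸ac≤1+n∸ab = ≤-trans (∸-monoʳ-≤ (suc n) ab≤1+ac) ([1+m]∸n≤1+[m∸n] n ∣ a - b ∣)

cycleDist-n≡cycleDist-0 : ∀ {n a} → a ≤ n → cycleDist n a n ≡ cycleDist n a 0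
cycleDist-n≡cycleDist-0 {n} {a} a≤n = begin
  ∣ a - n ∣ ⊓ (n ∸ ∣ a - n ∣) ≡⟨ cong (λ x → x ⊓ (n ∸ x)) (m≤n⇒∣m-n∣≡n∸m a≤n) ⟩
  (n ∸ a) ⊓ (n ∸ (n ∸ a))     ≡⟨ cong ((n ∸ a) ⊓_) (m∸[m∸n]≡n a≤n) ⟩
  (n ∸ a) ⊓ a                 ≡⟨ ⊓-comm (n ∸ a) a ⟩
  a ⊓ (n ∸ a)                 ≡⟨ cong (λ x → x ⊓ (n ∸ x)) (∣-∣-identityʳ a) ⟨
  ∣ a - 0 ∣ ⊓ (n ∸ ∣ a - 0 ∣) ∎
  where open ≡-Reasoning

CycleAdjacent : ℕ → ℕ → ℕ → Set
CycleAdjacent m a b = ∣ a - b ∣ ≡ 1 ⊎ ∣ a - b ∣ ≡ m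

cycleGraph-adjacent : ∀ m (w v : Fin (suc m)) → cycleGraph (suc m) w v ≡ true →
  CycleAdjacent m (toℕ w) (toℕ v)
cycleGraph-adjacent m w v e with ∨≡true⇒ _ _ e
... | inj₁ e′ = inj₁ (trans (sym (absDiff≡∣-∣ (toℕ w) (toℕ v))) (⌊⌋≡true⇒ (_ ≟ 1) e′))
... | inj₂ e′ = inj₂ (trans (sym (absDiff≡∣-∣ (toℕ w) (toℕ v))) (⌊⌋≡true⇒ (_ ≟ m) e′))

adjacent-cycleGraph : ∀ m (w v : Fin (suc m)) → CycleAdjacent m (toℕ w) (toℕ v) →
  cycleGraph (suc m) w v ≡ true
adjacent-cycleGraph m w v (inj₁ e) =
  ∨≡trueˡ _ (⇒⌊⌋≡true (_ ≟ 1) (trans (absDiff≡∣-∣ (toℕ w) (toℕ v)) e))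
adjacent-cycleGraph m w v (inj₂ e) =
  ∨≡trueʳ _ (⇒⌊⌋≡true (_ ≟ m) (trans (absDiff≡∣-∣ (toℕ w) (toℕ v)) e))

cycleDist-adjacent-step : ∀ m a b c → a ≤ m → b ≤ m → c ≤ m → CycleAdjacent m b c →
  cycleDist (suc m) a c ≤ suc (cycleDist (suc m) a b)
cycleDist-adjacent-step m a b c _ _ _ (inj₁ bc≡1) = cycleDist-unit-step (suc m) a b c bc≡1
cycleDist-adjacent-step m a b c a≤m b≤m c≤m (inj₂ bc≡m) with ∣a-b∣≡m⇒endpoints b≤m c≤m bc≡m
... | inj₁ (refl , refl) =
  subst (λ x → cycleDist (suc m) a m ≤ suc x) (cycleDist-n≡cycleDist-0 (m≤n⇒m≤1+n a≤m))
        (cycleDist-unit-step (suc m) a (suc m) m (∣1+a-a∣≡1 m))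
... | inj₂ (refl , refl) =
  subst (_≤ suc (cycleDist (suc m) a m)) (cycleDist-n≡cycleDist-0 (m≤n⇒m≤1+n a≤m))
        (cycleDist-unit-step (suc m) a m (suc m) (∣a-1+a∣≡1 m))

cycleDist-away : ∀ {m x d} a c → suc m ∸ x ≡ suc d → ∣ a - c ∣ ≡ suc x → cycleDist (suc m) a c ≤ d
cycleDist-away {m} {x} {d} a c m∸x≡1+d ac≡1+x = begin
  cycleDist (suc m) a c  ≤⟨ m⊓n≤n _ _ ⟩
  suc m ∸ ∣ a - c ∣      ≡⟨ cong (suc m ∸_) ac≡1+x ⟩
  m ∸ x                  ≡⟨ pred[m∸n]≡m∸[1+n] (suc m) x ⟨
  pred (suc m ∸ x)       ≡⟨ cong pred m∸x≡1+d ⟩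
  d                      ∎
  where open ≤-Reasoning

cycle-step-away : ∀ m a b d → a ≤ m → b ≤ m → a ≢ b → suc m ∸ ∣ a - b ∣ ≡ suc d →
  ∃ λ c → c ≤ m × CycleAdjacent m c b × cycleDist (suc m) a c ≤ d
cycle-step-away m a b d a≤m b≤m a≢b e with compare a b
... | equal .a = ⊥-elim (a≢b refl)
cycle-step-away m a b d a≤m b≤m a≢b e | less .a k with m≤n⇒m<n∨m≡n b≤m
... | inj₁ b<m = suc (suc (a + k)) , b<m , inj₁ (∣1+a-a∣≡1 (suc (a + k))) ,
  cycleDist-away a _ e (∣a-1+b∣≡1+∣a-b∣ (≤-trans (m≤m+n a k) (n≤1+n (a + k))))
... | inj₂ refl = 0 , z≤n , inj₂ refl , ≤-trans (m⊓n≤m _ _) (≤-reflexive a≡d)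
  where
  a≡d : ∣ a - 0 ∣ ≡ d
  a≡d = trans (∣-∣-identityʳ a) (suc-injective (trans (sym ([1+m]∸[m∸a]≡1+a a≤m))
          (trans (cong (suc m ∸_) (sym (m≤n⇒∣m-n∣≡n∸m a≤m))) e)))
cycle-step-away m a zero d a≤m b≤m a≢b e | greater .zero k =
  m , ≤-refl , inj₂ (∣-∣-identityʳ m) , ≤-trans (m⊓n≤m _ _) (≤-reflexive m∸a≡d)
  where
  m∸a≡d : ∣ suc k - m ∣ ≡ d
  m∸a≡d = trans (m≤n⇒∣m-n∣≡n∸m a≤m) (suc-injective (trans (sym (+-∸-assoc 1 a≤m)) e))
cycle-step-away m a (suc b) d a≤m b≤m a≢b e | greater .(suc b) k =
  b , ≤-trans (n≤1+n b) b≤m , inj₁ (∣a-1+a∣≡1 b) , cycleDist-away a b e ac≡1+ab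
  where
  y : ℕ
  y = suc (b + k)
  ac≡1+ab : ∣ suc y - b ∣ ≡ suc ∣ y - b ∣
  ac≡1+ab = trans (∣-∣-comm (suc y) b) (trans (∣a-1+b∣≡1+∣a-b∣ (≤-trans (m≤m+n b k) (n≤1+n (b + k))))
              (cong suc (∣-∣-comm b y)))

cycle-predecessor : ∀ m a b d → a ≤ m → b ≤ m → cycleDist (suc m) a b ≡ suc d →
  ∃ λ c → c ≤ m × CycleAdjacent m c b × cycleDist (suc m) a c ≤ d
cycle-predecessor m a b d a≤m b≤m ab≡1+d with ⊓-sel ∣ a - b ∣ (suc m ∸ ∣ a - b ∣)
... | inj₁ e with step-toward a b d (trans (sym e) ab≡1+d)
...   | c , ac≡d , cb≡1 , c≤a⊔b = c , ≤-trans c≤a⊔b (⊔-lub a≤m b≤m) , inj₁ cb≡1 ,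
                                  ≤-trans (m⊓n≤m _ _) (≤-reflexive ac≡d)
cycle-predecessor m a b d a≤m b≤m ab≡1+d | inj₂ e =
  cycle-step-away m a b d a≤m b≤m a≢b (trans (sym e) ab≡1+d)
  where
  a≢b : a ≢ b
  a≢b refl = 1+n≢0 (trans (sym ab≡1+d) (cong (λ x → x ⊓ (suc m ∸ x)) (∣n-n∣≡0 a)))

dist-cycleGraph : ∀ m (u v : Fin (suc m)) →
  dist (cycleGraph (suc m)) u v ≡ cycleDist (suc m) (toℕ u) (toℕ v)
dist-cycleGraph m u v =
  dist≡δ (cycleGraph (suc m)) u δ
    (λ v δv≡0 → toℕ-injective (cycleDist≡0⇒ (toℕ v) (toℕ≤pred[n] v) δv≡0))
    (cong (λ x → x ⊓ (suc m ∸ x)) (∣n-n∣≡0 (toℕ u)))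
    (λ w v wv → cycleDist-adjacent-step m (toℕ u) (toℕ w) (toℕ v)
                  (toℕ≤pred[n] u) (toℕ≤pred[n] w) (toℕ≤pred[n] v) (cycleGraph-adjacent m w v wv))
    predecessor
    v (≤-trans (m⊓n≤m _ _) (<⇒≤ (∣-∣<n (toℕ<n u) (toℕ<n v))))
  where
  δ : Fin (suc m) → ℕ
  δ x = cycleDist (suc m) (toℕ u) (toℕ x)

  cycleDist≡0⇒ : ∀ b → b ≤ m → cycleDist (suc m) (toℕ u) b ≡ 0 → toℕ u ≡ b
  cycleDist≡0⇒ b b≤m ub≡0 with ⊓-sel ∣ toℕ u - b ∣ (suc m ∸ ∣ toℕ u - b ∣)
  ... | inj₁ e = ∣m-n∣≡0⇒m≡n (trans (sym e) ub≡0)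
  ... | inj₂ e = ⊥-elim (<⇒≱ (∣-∣<n (toℕ<n u) (s≤s b≤m)) (m∸n≡0⇒m≤n (trans (sym e) ub≡0)))

  predecessor : ∀ v d → δ v ≡ suc d → ∃ λ w → cycleGraph (suc m) w v ≡ true × δ w ≤ d
  predecessor v d δv≡1+d with cycle-predecessor m (toℕ u) (toℕ v) d (toℕ≤pred[n] u) (toℕ≤pred[n] v) δv≡1+d
  ... | c , c≤m , cv , uc≤d =
    w , adjacent-cycleGraph m w v (subst (λ x → CycleAdjacent m x (toℕ v)) (sym w≡c) cv) ,
    subst (λ x → cycleDist (suc m) (toℕ u) x ≤ d) (sym w≡c) uc≤d
    where
    w : Fin (suc m)
    w = fromℕ< (s≤s c≤m)
    w≡c : toℕ w ≡ c
    w≡c = toℕ-fromℕ< (s≤s c≤m)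

-- A key (k , vertex) stands for the vertex k and (k , edge) for the edge {k , k + 1}.
data Kind : Set where
  vertex edge : Kind

extent : Kind → ℕ
extent vertex = 0
extent edge   = 1

j≤[1+j]∸extent : ∀ κ j → j ≤ suc j ∸ extent κ
j≤[1+j]∸extent vertex j = n≤1+n j
j≤[1+j]∸extent edge   j = ≤-refl

vertex≢edge : vertex ≢ edge
vertex≢edge ()

Key : Set
Key = ℕ × Kind

keyDist : (ℕ → ℕ → ℕ) → Key → ℕ → ℕ
keyDist D (k , vertex) v = D k v
keyDist D (k , edge)   v = D k v ⊓ D (suc k) v

Landmark : ∀ {n} → Subset n → ℕ → Set
Landmark S V = ∃ λ v → v ∈ S × toℕ v ≡ V

data Separates {n} (S : Subset n) (r : ℕ) (δ : Key → ℕ → ℕ) (p q : Key) : Set where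
  separated : ∀ {V} → Landmark S V → δ p V ⊓ suc r ≢ δ q V ⊓ suc r → Separates S r δ p q

farther-separates : ∀ {r a b} → a ≤ r → a < b → a ⊓ suc r ≢ b ⊓ suc r
farther-separates {r} {a} {b} a≤r a<b e =
  <-irrefl refl (≤-trans (⊓-glb a<b (s≤s a≤r))
                         (≤-reflexive (trans (sym e) (m≤n⇒m⊓n≡m (m≤n⇒m≤1+n a≤r)))))

module _ {n} {S : Subset n} {r : ℕ} where

  separated-by : ∀ {δ p q V} → Landmark S V → δ p V ≤ r → δ p V < δ q V → Separates S r δ p q
  separated-by L pV≤r pV<qV = separated L (farther-separates pV≤r pV<qV)

  separates-sym : ∀ {δ p q} → Separates S r δ p q → Separates S r δ q p
  separates-sym (separated L ne) = separated L (≢-sym ne)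

record Encoding {n} (G : Graph n) : Set₁ where
  field
    key           : Elem n → Key
    Valid         : Key → Set
    valid         : ∀ a → ValidElem G a → Valid (key a)
    key-injective : ∀ a b → ValidElem G a → ValidElem G b → key a ≡ key b → a ≡ b
    distance      : Key → ℕ → ℕ
    distE≡        : ∀ a v → ValidElem G a → distE G a v ≡ distance (key a) (toℕ v)
    key-vertex      : ∀ x → key (inj₁ x) ≡ (toℕ x , vertex)
    key-consecutive : ∀ u w → toℕ w ≡ suc (toℕ u) → key (inj₂ (u , w)) ≡ (toℕ u , edge)
    consecutive-adjacent : ∀ u w → toℕ w ≡ suc (toℕ u) → G u w ≡ true

  resolving : ∀ {r S} → (∀ p q → Valid p → Valid q → p ≢ q → Separates S r distance p q) →
    IsMixedResolving G r S
  resolving {r} separates a b va vb a≢b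
    with separates (key a) (key b) (valid a va) (valid b vb) (λ e → a≢b (key-injective a b va vb e))
  ... | separated (v , v∈S , refl) ne =
    v , v∈S , λ e → ne (trans (sym (cong (_⊓ suc r) (distE≡ a v va)))
                              (trans e (cong (_⊓ suc r) (distE≡ b v vb))))

Behind : ∀ {n} → Subset n → ℕ → ℕ → Set
Behind S r m = ∀ x → x ≤ m → ∃₂ λ U d → Landmark S U × U + d ≡ x × d < r

Ahead : ∀ {n} → Subset n → ℕ → ℕ → Set
Ahead S r m = ∀ x → x < m → ∃ λ j → Landmark S (x + suc j) × j < r

vertex-injective : ∀ {n} {x y : Fin n} → toℕ x ≡ toℕ y → inj₁ x ≡ inj₁ {B = Fin n × Fin n} y
vertex-injective x≡y = cong inj₁ (toℕ-injective x≡y)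

consecutive-injective : ∀ {n} {u w u′ w′ : Fin n} → toℕ w ≡ suc (toℕ u) → toℕ w′ ≡ suc (toℕ u′) →
  toℕ u ≡ toℕ u′ → inj₂ (u , w) ≡ inj₂ {A = Fin n} (u′ , w′)
consecutive-injective w≡ w′≡ u≡u′ with toℕ-injective u≡u′
... | refl = cong (λ w → inj₂ (_ , w)) (toℕ-injective (trans w≡ (sym w′≡)))

∣a-b∣≡1⇒b≡1+a : ∀ {a b} → a < b → ∣ a - b ∣ ≡ 1 → b ≡ suc a
∣a-b∣≡1⇒b≡1+a {a} {b} a<b ab≡1 = begin
  b           ≡⟨ m+[n∸m]≡n (<⇒≤ a<b) ⟨
  a + (b ∸ a) ≡⟨ cong (a +_) (trans (sym (m≤n⇒∣m-n∣≡n∸m (<⇒≤ a<b))) ab≡1) ⟩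
  a + 1       ≡⟨ +-comm a 1 ⟩
  suc a       ∎
  where open ≡-Reasoning

-- Counting landmarks in windows

LandmarkInWindow : ∀ {n} → Subset n → ℕ → ℕ → Set
LandmarkInWindow S r x = ∃ λ v → v ∈ S × x < toℕ v × toℕ v ≤ x + suc r

countBelow : ∀ {n} → Subset n → ℕ → ℕ
countBelow _           zero    = 0
countBelow []          (suc _) = 0
countBelow (true ∷ S)  (suc b) = suc (countBelow S b)
countBelow (false ∷ S) (suc b) = countBelow S b

countBelow≤∣∣ : ∀ {n} (S : Subset n) b → countBelow S b ≤ ∣ S ∣
countBelow≤∣∣ _           zero    = z≤n
countBelow≤∣∣ []          (suc _) = z≤n
countBelow≤∣∣ (true ∷ S)  (suc b) = s≤s (countBelow≤∣∣ S b)
countBelow≤∣∣ (false ∷ S) (suc b) = countBelow≤∣∣ S b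

countBelow-member : ∀ {n} (S : Subset n) (v : Fin n) lo hi → v ∈ S → lo ≤ toℕ v → toℕ v < hi →
  suc (countBelow S lo) ≤ countBelow S hi
countBelow-member (true ∷ S)  Fin.zero    zero     (suc hi) here      _          _              = s≤s z≤n
countBelow-member (true ∷ S)  (Fin.suc v) zero     (suc hi) (there v∈S) _          _          = s≤s z≤n
countBelow-member (false ∷ S) (Fin.suc v) zero     (suc hi) (there v∈S) _          (s≤s v<hi) =
  countBelow-member S v zero hi v∈S z≤n v<hi
countBelow-member (true ∷ S)  (Fin.suc v) (suc lo) (suc hi) (there v∈S) (s≤s lo≤v) (s≤s v<hi) =
  s≤s (countBelow-member S v lo hi v∈S lo≤v v<hi)
countBelow-member (false ∷ S) (Fin.suc v) (suc lo) (suc hi) (there v∈S) (s≤s lo≤v) (s≤s v<hi) =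
  countBelow-member S v lo hi v∈S lo≤v v<hi

windows-count : ∀ {n} (S : Subset n) w q →
  (∀ j → j < q → ∃ λ v → v ∈ S × j * w < toℕ v × toℕ v ≤ suc j * w) →
  q ≤ countBelow S (suc (q * w))
windows-count S w zero    _      = z≤n
windows-count S w (suc q) window with window q ≤-refl
... | v , v∈S , qw<v , v≤[1+q]w =
  ≤-trans (s≤s (windows-count S w q (λ j j<q → window j (m<n⇒m<1+n j<q))))
          (countBelow-member S v (suc (q * w)) (suc (suc q * w)) v∈S qw<v (s≤s v≤[1+q]w))

lower-bound-from-windows : ∀ {m} (S : Subset (suc m)) r →
  (∀ x → x + suc r ≤ m → LandmarkInWindow S r x) →
  suc m ≤ suc ∣ S ∣ * suc r
lower-bound-from-windows {m} S r window = begin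
  suc m              ≤⟨ m<[1+q]*[1+r] ⟩
  suc q * suc r      ≤⟨ *-monoˡ-≤ (suc r) (s≤s q≤∣S∣) ⟩
  suc ∣ S ∣ * suc r  ∎
  where
  open ≤-Reasoning
  q : ℕ
  q = m / suc r

  m<[1+q]*[1+r] : m < suc q * suc r
  m<[1+q]*[1+r] = begin-strict
    m                     ≡⟨ m≡m%n+[m/n]*n m (suc r) ⟩
    m % suc r + q * suc r <⟨ +-monoˡ-< (q * suc r) (m%n<n m (suc r)) ⟩
    suc r + q * suc r     ∎

  window-j : ∀ j → j < q → ∃ λ v → v ∈ S × j * suc r < toℕ v × toℕ v ≤ suc j * suc r
  window-j j j<q with window (j * suc r) (≤-trans (≤-reflexive (+-comm (j * suc r) (suc r)))
                                          (≤-trans (*-monoˡ-≤ (suc r) j<q) (m/n*n≤m m (suc r))))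
  ... | v , v∈S , lo , hi = v , v∈S , lo , ≤-trans hi (≤-reflexive (+-comm (j * suc r) (suc r)))

  q≤∣S∣ : q ≤ ∣ S ∣
  q≤∣S∣ = ≤-trans (windows-count S (suc r) q window-j) (countBelow≤∣∣ S (suc (q * suc r)))

landmark-in-window : ∀ {n} {G : Graph n} {r S} → IsMixedResolving G r S →
  ∀ a b x → ValidElem G a → ValidElem G b → a ≢ b →
  (∀ v → toℕ v ≤ x ⊎ x + suc r < toℕ v → distR G r a v ≡ distR G r b v) →
  LandmarkInWindow S r x
landmark-in-window resolving a b x va vb a≢b agree with resolving a b va vb a≢b
... | v , v∈S , differ with toℕ v ≤? x
...   | yes v≤x = ⊥-elim (differ (agree v (inj₁ v≤x)))
...   | no v≰x with toℕ v ≤? x + suc _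
...     | yes v≤x+1+r = v , v∈S , ≰⇒> v≰x , v≤x+1+r
...     | no v≰x+1+r = ⊥-elim (differ (agree v (inj₂ (≰⇒> v≰x+1+r))))

beyond-window : ∀ {x r v} → x + suc r < v → ∃ λ j → x + suc j ≡ v × suc r ≤ j
beyond-window {x} {r} x+1+r<v with m≤n⇒∃[o]m+o≡n x+1+r<v
... | g , e = suc (r + g) , trans (shape x r g) e , s≤s (m≤m+n r g)
  where
  shape : ∀ x r g → x + suc (suc (r + g)) ≡ suc (x + suc r) + g
  shape = solve-∀

KindsAgreeOutside : (Key → ℕ → ℕ) → ℕ → ℕ → Set
KindsAgreeOutside δ r x =
  ∀ v → v ≤ x ⊎ x + suc r < v → δ (x , vertex) v ⊓ suc r ≡ δ (x , edge) v ⊓ suc r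

module _ {m} {G : Graph (suc m)} (E : Encoding G) where
  open Encoding E

  consecutive-valid : ∀ u w → toℕ w ≡ suc (toℕ u) → ValidElem G (inj₂ (u , w))
  consecutive-valid u w w≡1+u = subst (toℕ u <_) (sym w≡1+u) ≤-refl , consecutive-adjacent u w w≡1+u

  distR-vertex : ∀ r x v → distR G r (inj₁ x) v ≡ distance (toℕ x , vertex) (toℕ v) ⊓ suc r
  distR-vertex r x v =
    cong (_⊓ suc r) (trans (distE≡ (inj₁ x) v _) (cong (λ p → distance p (toℕ v)) (key-vertex x)))

  distR-consecutive : ∀ r u w v → toℕ w ≡ suc (toℕ u) →
    distR G r (inj₂ (u , w)) v ≡ distance (toℕ u , edge) (toℕ v) ⊓ suc r
  distR-consecutive r u w v w≡1+u = cong (_⊓ suc r)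
    (trans (distE≡ (inj₂ (u , w)) v (consecutive-valid u w w≡1+u))
           (cong (λ p → distance p (toℕ v)) (key-consecutive u w w≡1+u)))

  encoded-window : ∀ {r S} → IsMixedResolving G r S →
    ∀ x (u w : Fin (suc m)) → toℕ u ≡ x → toℕ w ≡ suc x → KindsAgreeOutside distance r x →
    LandmarkInWindow S r x
  encoded-window {r} res x u w refl w≡1+u agree =
    landmark-in-window res (inj₁ u) (inj₂ (u , w)) x _ (consecutive-valid u w w≡1+u) (λ ()) λ v out →
      trans (distR-vertex r u v) (trans (agree (toℕ v) out) (sym (distR-consecutive r u w v w≡1+u)))

  encoded-lower-bound : ∀ {r S} → (∀ x → x + suc r ≤ m → KindsAgreeOutside distance r x) →
    IsMixedResolving G r S → suc m ≤ suc ∣ S ∣ * suc r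
  encoded-lower-bound {r} {S} agree res = lower-bound-from-windows S r λ x x+1+r≤m →
    let 1+x<1+m : suc x < suc m
        1+x<1+m = s≤s (≤-trans (s≤s (m≤m+n x r)) (≤-trans (≤-reflexive (sym (+-suc x r))) x+1+r≤m))
        x<1+m : x < suc m
        x<1+m = <-trans (n<1+n x) 1+x<1+m
    in encoded-window res x (fromℕ< x<1+m) (fromℕ< 1+x<1+m) (toℕ-fromℕ< x<1+m) (toℕ-fromℕ< 1+x<1+m)
         (agree x x+1+r≤m)

-- Paths

pathDist-below : ∀ κ v d {k} → v + d ≡ k → keyDist ∣_-_∣ (k , κ) v ≡ d
pathDist-below vertex v d refl = ∣a+d-a∣≡d v d
pathDist-below edge   v d refl = begin
  ∣ v + d - v ∣ ⊓ ∣ suc (v + d) - v ∣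
    ≡⟨ cong₂ _⊓_ (∣a+d-a∣≡d v d) (trans (cong ∣_- v ∣ (sym (+-suc v d))) (∣a+d-a∣≡d v (suc d))) ⟩
  d ⊓ suc d
    ≡⟨ m≤n⇒m⊓n≡m (n≤1+n d) ⟩
  d ∎
  where open ≡-Reasoning

pathDist-above : ∀ κ k j → keyDist ∣_-_∣ (k , κ) (k + suc j) ≡ suc j ∸ extent κ
pathDist-above vertex k j = ∣m-m+n∣≡n k (suc j)
pathDist-above edge   k j = begin
  ∣ k - k + suc j ∣ ⊓ ∣ suc k - k + suc j ∣
    ≡⟨ cong₂ _⊓_ (∣m-m+n∣≡n k (suc j)) (trans (cong ∣ suc k -_∣ (+-suc k j)) (∣m-m+n∣≡n k j)) ⟩
  suc j ⊓ j
    ≡⟨ m≥n⇒m⊓n≡n (n≤1+n j) ⟩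
  j ∎
  where open ≡-Reasoning

PathKey : ℕ → Key → Set
PathKey m (k , vertex) = k ≤ m
PathKey m (k , edge)   = k < m

PathKey⇒≤ : ∀ {m} p → PathKey m p → proj₁ p ≤ m
PathKey⇒≤ (k , vertex) k≤m = k≤m
PathKey⇒≤ (k , edge)   k<m = <⇒≤ k<m

module _ {m r} {S : Subset (suc m)} (behind : Behind S r m) (ahead : Ahead S r m) where

  private
    δ : Key → ℕ → ℕ
    δ = keyDist ∣_-_∣

  path-separates-< : ∀ k e κ κ′ → k ≤ m → Separates S r δ (k , κ) (suc (k + e) , κ′)
  path-separates-< k e κ κ′ k≤m with behind k k≤m
  ... | U , d , L , refl , d<r = separated-by L (≤-trans (≤-reflexive p-at-U) (<⇒≤ d<r))
                                   (subst₂ _<_ (sym p-at-U) (sym q-at-U) (m<m+n d (s≤s z≤n)))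
    where
    p-at-U : δ (U + d , κ) U ≡ d
    p-at-U = pathDist-below κ U d refl
    q-at-U : δ (suc (U + d + e) , κ′) U ≡ d + suc e
    q-at-U = pathDist-below κ′ U (d + suc e) (sym (1+[a+d+e]≡a+[d+1+e] U d e))

  path-separates-edge-vertex : ∀ k → k < m → Separates S r δ (k , edge) (k , vertex)
  path-separates-edge-vertex k k<m with ahead k k<m
  ... | j , L , j<r = separated-by L
    (≤-trans (≤-reflexive (pathDist-above edge k j)) (<⇒≤ j<r))
    (subst₂ _<_ (sym (pathDist-above edge k j)) (sym (pathDist-above vertex k j)) ≤-refl)

  path-separates : ∀ p q → PathKey m p → PathKey m q → p ≢ q → Separates S r δ p q
  path-separates (k , κ) (k′ , κ′) vp vq p≢q with compare k k′
  ... | less .k e     = path-separates-< k e κ κ′ (PathKey⇒≤ (k , κ) vp)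
  ... | greater .k′ e = separates-sym (path-separates-< k′ e κ′ κ (PathKey⇒≤ (k′ , κ′) vq))
  path-separates (k , vertex) (.k , vertex) vp vq p≢q | equal .k = ⊥-elim (p≢q refl)
  path-separates (k , edge)   (.k , edge)   vp vq p≢q | equal .k = ⊥-elim (p≢q refl)
  path-separates (k , vertex) (.k , edge)   vp vq p≢q | equal .k = separates-sym (path-separates-edge-vertex k vq)
  path-separates (k , edge)   (.k , vertex) vp vq p≢q | equal .k = path-separates-edge-vertex k vp

path-consecutive : ∀ {n} (u w : Fin n) → ValidElem (pathGraph n) (inj₂ (u , w)) → toℕ w ≡ suc (toℕ u)
path-consecutive u w (u<w , uw) = ∣a-b∣≡1⇒b≡1+a u<w (pathGraph-adjacent u w uw)

pathKey : ∀ {n} → Elem n → Key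
pathKey (inj₁ x)       = toℕ x , vertex
pathKey (inj₂ (u , _)) = toℕ u , edge

pathEncoding : ∀ m → Encoding (pathGraph (suc m))
pathEncoding m = record
  { key           = pathKey
  ; Valid         = PathKey m
  ; valid         = valid
  ; key-injective = injective
  ; distance      = keyDist ∣_-_∣
  ; distE≡        = distE≡
  ; key-vertex      = λ _ → refl
  ; key-consecutive = λ _ _ _ → refl
  ; consecutive-adjacent = λ u w w≡1+u →
      adjacent-pathGraph u w (trans (cong ∣ toℕ u -_∣ w≡1+u) (∣a-1+a∣≡1 (toℕ u)))
  }
  where
  G : Graph (suc m)
  G = pathGraph (suc m)

  valid : ∀ a → ValidElem G a → PathKey m (pathKey a)
  valid (inj₁ x)       _  = toℕ≤pred[n] x
  valid (inj₂ (u , w)) va = subst (_≤ m) (path-consecutive u w va) (toℕ≤pred[n] w)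

  injective : ∀ a b → ValidElem G a → ValidElem G b → pathKey a ≡ pathKey b → a ≡ b
  injective (inj₁ x)       (inj₁ y)         _  _  e = vertex-injective (cong proj₁ e)
  injective (inj₂ (u , w)) (inj₂ (u′ , w′)) va vb e =
    consecutive-injective (path-consecutive u w va) (path-consecutive u′ w′ vb) (cong proj₁ e)
  injective (inj₁ _)       (inj₂ _)         _  _  e = ⊥-elim (vertex≢edge (cong proj₂ e))
  injective (inj₂ _)       (inj₁ _)         _  _  e = ⊥-elim (vertex≢edge (cong proj₂ (sym e)))

  distE≡ : ∀ a v → ValidElem G a → distE G a v ≡ keyDist ∣_-_∣ (pathKey a) (toℕ v)
  distE≡ (inj₁ x)       v _  = dist-pathGraph (suc m) x v
  distE≡ (inj₂ (u , w)) v va = cong₂ _⊓_ (dist-pathGraph (suc m) u v)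
    (trans (dist-pathGraph (suc m) w v) (cong ∣_- toℕ v ∣ (path-consecutive u w va)))

path-kinds-agree-outside : ∀ {r} κ κ′ x v → v ≤ x ⊎ x + suc r < v →
  keyDist ∣_-_∣ (x , κ) v ⊓ suc r ≡ keyDist ∣_-_∣ (x , κ′) v ⊓ suc r
path-kinds-agree-outside {r} κ κ′ x v (inj₁ v≤x) with m≤n⇒∃[o]m+o≡n v≤x
... | d , v+d≡x = cong (_⊓ suc r) (trans (pathDist-below κ v d v+d≡x) (sym (pathDist-below κ′ v d v+d≡x)))
path-kinds-agree-outside {r} κ κ′ x v (inj₂ x+1+r<v) with beyond-window x+1+r<v
... | j , refl , 1+r≤j = trans (truncated κ) (sym (truncated κ′))
  where
  truncated : ∀ κ → keyDist ∣_-_∣ (x , κ) (x + suc j) ⊓ suc r ≡ suc r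
  truncated κ = trans (cong (_⊓ suc r) (pathDist-above κ x j))
                      (m≥n⇒m⊓n≡n (≤-trans 1+r≤j (j≤[1+j]∸extent κ j)))

path-lower-bound : ∀ {m r S} → IsMixedResolving (pathGraph (suc m)) r S → suc m ≤ suc ∣ S ∣ * suc r
path-lower-bound {m} = encoded-lower-bound (pathEncoding m) λ x _ v → path-kinds-agree-outside vertex edge x v

path-resolving : ∀ {m r} {S : Subset (suc m)} → Behind S r m → Ahead S r m → IsMixedResolving (pathGraph (suc m)) r S
path-resolving {m} behind ahead = Encoding.resolving (pathEncoding m) (path-separates behind ahead)

-- Cycles

[1+m]∸d∸1≡m∸d : ∀ m d → suc m ∸ d ∸ 1 ≡ m ∸ d
[1+m]∸d∸1≡m∸d m d = trans (∸-+-assoc (suc m) d 1) (cong (suc m ∸_) (+-comm d 1))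

cycleDist-below : ∀ m κ v d {k} → v + d ≡ k →
  keyDist (cycleDist (suc m)) (k , κ) v ≡ d ⊓ (suc m ∸ d ∸ extent κ)
cycleDist-below m vertex v d refl = cong (λ x → x ⊓ (suc m ∸ x)) (∣a+d-a∣≡d v d)
cycleDist-below m edge v d refl = begin
  cycleDist (suc m) (v + d) v ⊓ cycleDist (suc m) (suc (v + d)) v
    ≡⟨ cong₂ _⊓_ (cong (λ x → x ⊓ (suc m ∸ x)) (∣a+d-a∣≡d v d))
                 (cong (λ x → x ⊓ (suc m ∸ x))
                       (trans (cong ∣_- v ∣ (sym (+-suc v d))) (∣a+d-a∣≡d v (suc d)))) ⟩
  (d ⊓ (suc m ∸ d)) ⊓ (suc d ⊓ (m ∸ d))
    ≡⟨ ⊓-pair (n≤1+n d) (∸-monoʳ-≤ (suc m) (n≤1+n d)) ⟩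
  d ⊓ (m ∸ d)
    ≡⟨ cong (d ⊓_) ([1+m]∸d∸1≡m∸d m d) ⟨
  d ⊓ (suc m ∸ d ∸ 1) ∎
  where open ≡-Reasoning

cycleDist-above : ∀ m κ k j →
  keyDist (cycleDist (suc m)) (k , κ) (k + suc j) ≡ (suc m ∸ suc j) ⊓ (suc j ∸ extent κ)
cycleDist-above m vertex k j =
  trans (cong (λ x → x ⊓ (suc m ∸ x)) (∣m-m+n∣≡n k (suc j))) (⊓-comm (suc j) (m ∸ j))
cycleDist-above m edge k j = begin
  cycleDist (suc m) k (k + suc j) ⊓ cycleDist (suc m) (suc k) (k + suc j)
    ≡⟨ cong₂ _⊓_ (cong (λ x → x ⊓ (suc m ∸ x)) (∣m-m+n∣≡n k (suc j)))
                 (cong (λ x → x ⊓ (suc m ∸ x)) (trans (cong ∣ suc k -_∣ (+-suc k j)) (∣m-m+n∣≡n k j))) ⟩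
  (suc j ⊓ (m ∸ j)) ⊓ (j ⊓ (suc m ∸ j))
    ≡⟨ cong₂ _⊓_ (⊓-comm (suc j) (m ∸ j)) (⊓-comm j (suc m ∸ j)) ⟩
  ((m ∸ j) ⊓ suc j) ⊓ ((suc m ∸ j) ⊓ j)
    ≡⟨ ⊓-pair (∸-monoʳ-≤ (suc m) (n≤1+n j)) (n≤1+n j) ⟩
  (m ∸ j) ⊓ j ∎
  where open ≡-Reasoning

m∸d≤[1+m]∸d∸extent : ∀ κ m d → m ∸ d ≤ suc m ∸ d ∸ extent κ
m∸d≤[1+m]∸d∸extent vertex m d = ∸-monoˡ-≤ d (n≤1+n m)
m∸d≤[1+m]∸d∸extent edge   m d = ≤-reflexive (sym ([1+m]∸d∸1≡m∸d m d))

4*r≡[r+r]+[r+r] : ∀ r → 4 * r ≡ (r + r) + (r + r)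
4*r≡[r+r]+[r+r] = solve-∀

wrap-gap : ∀ {r d d′ e} → 4 * r ≤ d + suc e + d → d < r → d′ < r → d′ + suc d′ ≤ e
wrap-gap {r} {d} {d′} {e} 4r≤ d<r d′<r = ≤-trans (+-mono-≤ (<⇒≤ d′<r) d′<r) (<⇒≤ r+r<e)
  where
  shape : ∀ d e → suc (d + suc e + d) ≡ suc d + suc d + e
  shape = solve-∀
  r+r<e : r + r < e
  r+r<e = +-cancelˡ-< (r + r) (r + r) e (begin-strict
    (r + r) + (r + r) ≡⟨ 4*r≡[r+r]+[r+r] r ⟨
    4 * r             ≤⟨ 4r≤ ⟩
    d + suc e + d     <⟨ ≤-reflexive (shape d e) ⟩
    suc d + suc d + e ≤⟨ +-monoˡ-≤ e (+-mono-≤ d<r d<r) ⟩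
    r + r + e         ∎)
    where open ≤-Reasoning

module _ {m r} {S : Subset (suc m)} (4r≤m : 4 * r ≤ m) (behind : Behind S r m) (ahead : Ahead S r m) where

  private
    δ : Key → ℕ → ℕ
    δ = keyDist (cycleDist (suc m))

  a,b≤r⇒a+b≤m : ∀ {a b} → a ≤ r → b ≤ r → a + b ≤ m
  a,b≤r⇒a+b≤m a≤r b≤r = ≤-trans (+-mono-≤ a≤r b≤r)
    (≤-trans (m≤m+n (r + r) (r + r)) (≤-trans (≤-reflexive (sym (4*r≡[r+r]+[r+r] r))) 4r≤m))

  cycleDist-near : ∀ κ {v d k} → v + d ≡ k → d < r → δ (k , κ) v ≡ d
  cycleDist-near κ {v} {d} v+d≡k d<r = trans (cycleDist-below m κ v d v+d≡k) (m≤n⇒m⊓n≡m d≤)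
    where
    d≤ : d ≤ suc m ∸ d ∸ extent κ
    d≤ = ≤-trans (m+n≤o⇒m≤o∸n d (a,b≤r⇒a+b≤m (<⇒≤ d<r) (<⇒≤ d<r))) (m∸d≤[1+m]∸d∸extent κ m d)

  -- If the landmark U just below k does not separate, then q lies at distance d from U the other
  -- way round the cycle; so k′ is more than 2r above k, and the landmark just below k′ separates.
  cycle-separates-< : ∀ k e κ κ′ → suc (k + e) ≤ m → Separates S r δ (k , κ) (suc (k + e) , κ′)
  cycle-separates-< k e κ κ′ k′≤m with behind k (≤-trans (m≤m+n k e) (≤-trans (n≤1+n _) k′≤m))
  ... | U , d , L , refl , d<r with suc d ≤? m ∸ (d + suc e)
  ... | yes 1+d≤m∸D = separated-by L (≤-trans (≤-reflexive p-at-U) (<⇒≤ d<r))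
        (subst₂ _<_ (sym p-at-U) (sym q-at-U) (⊓-glb (m<m+n d (s≤s z≤n))
                                                     (≤-trans 1+d≤m∸D (m∸d≤[1+m]∸d∸extent κ′ m (d + suc e)))))
    where
    p-at-U : δ (U + d , κ) U ≡ d
    p-at-U = cycleDist-near κ refl d<r
    q-at-U : δ (suc (U + d + e) , κ′) U ≡ (d + suc e) ⊓ (suc m ∸ (d + suc e) ∸ extent κ′)
    q-at-U = cycleDist-below m κ′ U (d + suc e) (sym (1+[a+d+e]≡a+[d+1+e] U d e))
  ... | no m∸D≰d with behind (suc (U + d + e)) k′≤m
  ... | U′ , d′ , L′ , U′+d′≡k′ , d′<r with m≤n⇒∃[o]m+o≡n (wrap-gap 4r≤D+d d<r d′<r)
    where
    4r≤D+d : 4 * r ≤ d + suc e + d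
    4r≤D+d = ≤-trans 4r≤m
      (≤-trans (m≤n+m∸n m (d + suc e)) (+-monoʳ-≤ (d + suc e) (s≤s⁻¹ (≰⇒> m∸D≰d))))
  ... | f , gap≡e = separates-sym (separated-by L′ (≤-trans (≤-reflexive q-at-U′) (<⇒≤ d′<r))
        (subst₂ _<_ (sym q-at-U′) (sym p-at-U′)
                (⊓-glb 1+d′≤m∸j′ (≤-trans (s≤s (m≤m+n d′ f)) (j≤[1+j]∸extent κ j′)))))
    where
    j′ : ℕ
    j′ = suc (d′ + f)
    k′≡ : suc (U + d + e) ≡ (U + d) + (suc j′ + d′)
    k′≡ = trans (cong (λ x → suc (U + d + x)) (sym gap≡e)) (shape (U + d) d′ f)
      where
      shape : ∀ a d′ f → suc (a + (d′ + suc d′ + f)) ≡ a + (suc (suc (d′ + f)) + d′)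
      shape = solve-∀
    U′≡ : U′ ≡ U + d + suc j′
    U′≡ = +-cancelʳ-≡ d′ U′ (U + d + suc j′)
            (trans U′+d′≡k′ (trans k′≡ (sym (+-assoc (U + d) (suc j′) d′))))
    p-at-U′ : δ (U + d , κ) U′ ≡ (suc m ∸ suc j′) ⊓ (suc j′ ∸ extent κ)
    p-at-U′ = trans (cong (δ (U + d , κ)) U′≡) (cycleDist-above m κ (U + d) j′)
    q-at-U′ : δ (suc (U + d + e) , κ′) U′ ≡ d′
    q-at-U′ = cycleDist-near κ′ U′+d′≡k′ d′<r
    1+d′≤m∸j′ : suc d′ ≤ suc m ∸ suc j′
    1+d′≤m∸j′ = m+n≤o⇒m≤o∸n (suc d′) (s≤s (≤-trans (≤-reflexive (+-comm d′ (suc j′)))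
                  (≤-trans (m≤n+m (suc j′ + d′) (U + d)) (≤-trans (≤-reflexive (sym k′≡)) k′≤m))))

  cycle-separates-edge-vertex-< : ∀ k → k < m → Separates S r δ (k , edge) (k , vertex)
  cycle-separates-edge-vertex-< k k<m with ahead k k<m
  ... | j , L , j<r = separated-by L (≤-trans (≤-reflexive edge≡j) (<⇒≤ j<r))
                        (subst₂ _<_ (sym edge≡j) (sym vertex≡1+j) ≤-refl)
    where
    1+j≤m∸j : suc j ≤ m ∸ j
    1+j≤m∸j = m+n≤o⇒m≤o∸n (suc j) (a,b≤r⇒a+b≤m j<r (<⇒≤ j<r))
    edge≡j : δ (k , edge) (k + suc j) ≡ j
    edge≡j = trans (cycleDist-above m edge k j) (m≥n⇒m⊓n≡n (≤-trans (n≤1+n j) 1+j≤m∸j))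
    vertex≡1+j : δ (k , vertex) (k + suc j) ≡ suc j
    vertex≡1+j = trans (cycleDist-above m vertex k j) (m≥n⇒m⊓n≡n 1+j≤m∸j)

  cycle-separates-edge-vertex-m : Separates S r δ (m , edge) (m , vertex)
  cycle-separates-edge-vertex-m with behind 0 z≤n
  ... | U , d , L , U+d≡0 , d<r with m+n≡0⇒m≡0 U U+d≡0
  ... | refl = separated-by L (≤-trans (≤-reflexive edge≡0) z≤n)
                              (subst₂ _<_ (sym edge≡0) (sym vertex≡1) ≤-refl)
    where
    0<m : 0 < m
    0<m = ≤-trans (≤-trans (s≤s z≤n) d<r) (≤-trans (m≤m+n r (3 * r)) 4r≤m)
    edge≡0 : δ (m , edge) 0 ≡ 0
    edge≡0 = trans (cycleDist-below m edge 0 m refl)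
               (trans (cong (m ⊓_) (trans ([1+m]∸d∸1≡m∸d m m) (n∸n≡0 m))) (⊓-zeroʳ m))
    vertex≡1 : δ (m , vertex) 0 ≡ 1
    vertex≡1 = trans (cycleDist-below m vertex 0 m refl) (trans (cong (m ⊓_) (m+n∸n≡m 1 m)) (m≥n⇒m⊓n≡n 0<m))

  cycle-separates-edge-vertex : ∀ k → k ≤ m → Separates S r δ (k , edge) (k , vertex)
  cycle-separates-edge-vertex k k≤m with m≤n⇒m<n∨m≡n k≤m
  ... | inj₁ k<m = cycle-separates-edge-vertex-< k k<m
  ... | inj₂ refl = cycle-separates-edge-vertex-m

  cycle-separates : ∀ p q → proj₁ p ≤ m → proj₁ q ≤ m → p ≢ q → Separates S r δ p q
  cycle-separates (k , κ) (k′ , κ′) k≤m k′≤m p≢q with compare k k′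
  ... | less .k e     = cycle-separates-< k e κ κ′ k′≤m
  ... | greater .k′ e = separates-sym (cycle-separates-< k′ e κ′ κ k≤m)
  cycle-separates (k , vertex) (.k , vertex) _ _ p≢q | equal .k = ⊥-elim (p≢q refl)
  cycle-separates (k , edge)   (.k , edge)   _ _ p≢q | equal .k = ⊥-elim (p≢q refl)
  cycle-separates (k , vertex) (.k , edge)   k≤m _ _ | equal .k = separates-sym (cycle-separates-edge-vertex k k≤m)
  cycle-separates (k , edge)   (.k , vertex) k≤m _ _ | equal .k = cycle-separates-edge-vertex k k≤m

cycleDist-comm : ∀ n a b → cycleDist n a b ≡ cycleDist n b a
cycleDist-comm n a b = cong (λ x → x ⊓ (n ∸ x)) (∣-∣-comm a b)

-- The edge {0 , m} of the cycle on m + 1 vertices gets the key (m , edge): for cycleDist (m + 1)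
-- the position m + 1 is the vertex 0.
edgeKey : ∀ {n} → Fin n → Fin n → Key
edgeKey u w with toℕ w ≟ suc (toℕ u)
... | yes _ = toℕ u , edge
... | no _  = toℕ w , edge

cycleKey : ∀ {n} → Elem n → Key
cycleKey (inj₁ x)       = toℕ x , vertex
cycleKey (inj₂ (u , w)) = edgeKey u w

edgeKey-consecutive : ∀ {n} (u w : Fin n) → toℕ w ≡ suc (toℕ u) → edgeKey u w ≡ (toℕ u , edge)
edgeKey-consecutive u w w≡1+u with toℕ w ≟ suc (toℕ u)
... | yes _    = refl
... | no w≢1+u = ⊥-elim (w≢1+u w≡1+u)

edgeKey-kind : ∀ {n} (u w : Fin n) → proj₂ (edgeKey u w) ≡ edge
edgeKey-kind u w with toℕ w ≟ suc (toℕ u)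
... | yes _ = refl
... | no _  = refl

data CycleEdgeView {m} (u w : Fin (suc m)) : Key → Set where
  consecutive : toℕ w ≡ suc (toℕ u) → CycleEdgeView u w (toℕ u , edge)
  wrap        : toℕ u ≡ 0 → toℕ w ≡ m → CycleEdgeView u w (m , edge)

cycleEdgeView : ∀ {m} (u w : Fin (suc m)) → ValidElem (cycleGraph (suc m)) (inj₂ (u , w)) →
  CycleEdgeView u w (edgeKey u w)
cycleEdgeView {m} u w (u<w , uw) with toℕ w ≟ suc (toℕ u)
... | yes w≡1+u = consecutive w≡1+u
... | no w≢1+u with cycleGraph-adjacent m u w uw
...   | inj₁ uw≡1 = ⊥-elim (w≢1+u (∣a-b∣≡1⇒b≡1+a u<w uw≡1))
...   | inj₂ uw≡m with ∣a-b∣≡m⇒endpoints (toℕ≤pred[n] u) (toℕ≤pred[n] w) uw≡m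
...     | inj₁ (u≡0 , w≡m) = subst (CycleEdgeView u w) (cong (_, edge) (sym w≡m)) (wrap u≡0 w≡m)
...     | inj₂ (_ , w≡0) = ⊥-elim (<⇒≱ u<w (≤-trans (≤-reflexive w≡0) z≤n))

cycleEncoding : ∀ m → Encoding (cycleGraph (suc m))
cycleEncoding m = record
  { key           = cycleKey
  ; Valid         = λ p → proj₁ p ≤ m
  ; valid         = valid
  ; key-injective = injective
  ; distance      = keyDist (cycleDist (suc m))
  ; distE≡        = distE≡
  ; key-vertex      = λ _ → refl
  ; key-consecutive = edgeKey-consecutive
  ; consecutive-adjacent = λ u w w≡1+u →
      adjacent-cycleGraph m u w (inj₁ (trans (cong ∣ toℕ u -_∣ w≡1+u) (∣a-1+a∣≡1 (toℕ u))))
  }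
  where
  G : Graph (suc m)
  G = cycleGraph (suc m)

  valid : ∀ a → ValidElem G a → proj₁ (cycleKey a) ≤ m
  valid (inj₁ x)       _  = toℕ≤pred[n] x
  valid (inj₂ (u , w)) va with edgeKey u w | cycleEdgeView u w va
  ... | _ | consecutive _ = toℕ≤pred[n] u
  ... | _ | wrap _ _          = ≤-refl

  wrap≢consecutive : ∀ {u w : Fin (suc m)} → toℕ w ≡ suc (toℕ u) → toℕ u ≢ m
  wrap≢consecutive {u} {w} w≡1+u u≡m =
    <-irrefl refl (≤-trans (≤-reflexive (cong suc (sym u≡m))) (subst (_≤ m) w≡1+u (toℕ≤pred[n] w)))

  injective : ∀ a b → ValidElem G a → ValidElem G b → cycleKey a ≡ cycleKey b → a ≡ b
  injective (inj₁ x)       (inj₁ y)         _  _  e = vertex-injective (cong proj₁ e)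
  injective (inj₂ (u , w)) (inj₂ (u′ , w′)) va vb e
    with edgeKey u w | cycleEdgeView u w va | edgeKey u′ w′ | cycleEdgeView u′ w′ vb
  ... | _ | consecutive w≡ | _ | consecutive w′≡ = consecutive-injective w≡ w′≡ (cong proj₁ e)
  ... | _ | consecutive w≡ | _ | wrap _ _ = ⊥-elim (wrap≢consecutive w≡ (cong proj₁ e))
  ... | _ | wrap _ _ | _ | consecutive w′≡ = ⊥-elim (wrap≢consecutive w′≡ (cong proj₁ (sym e)))
  ... | _ | wrap u≡0 w≡m | _ | wrap u′≡0 w′≡m =
    cong₂ (λ u w → inj₂ (u , w)) (toℕ-injective (trans u≡0 (sym u′≡0)))
                                 (toℕ-injective (trans w≡m (sym w′≡m)))
  injective (inj₁ _)       (inj₂ (u , w))   _  _  e =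
    ⊥-elim (vertex≢edge (trans (cong proj₂ e) (edgeKey-kind u w)))
  injective (inj₂ (u , w)) (inj₁ _)         _  _  e =
    ⊥-elim (vertex≢edge (trans (cong proj₂ (sym e)) (edgeKey-kind u w)))

  distE≡ : ∀ a v → ValidElem G a → distE G a v ≡ keyDist (cycleDist (suc m)) (cycleKey a) (toℕ v)
  distE≡ (inj₁ x)       v _  = dist-cycleGraph m x v
  distE≡ (inj₂ (u , w)) v va with edgeKey u w | cycleEdgeView u w va
  ... | _ | consecutive w≡1+u = cong₂ _⊓_ (dist-cycleGraph m u v)
          (trans (dist-cycleGraph m w v) (cong (λ x → cycleDist (suc m) x (toℕ v)) w≡1+u))
  ... | _ | wrap u≡0 w≡m = begin
    dist G u v ⊓ dist G w v
      ≡⟨ cong₂ _⊓_ (trans (dist-cycleGraph m u v) (cong (λ x → cycleDist (suc m) x (toℕ v)) u≡0))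
                   (trans (dist-cycleGraph m w v) (cong (λ x → cycleDist (suc m) x (toℕ v)) w≡m)) ⟩
    cycleDist (suc m) 0 (toℕ v) ⊓ cycleDist (suc m) m (toℕ v)
      ≡⟨ ⊓-comm _ _ ⟩
    cycleDist (suc m) m (toℕ v) ⊓ cycleDist (suc m) 0 (toℕ v)
      ≡⟨ cong (cycleDist (suc m) m (toℕ v) ⊓_) 0≡1+m ⟩
    cycleDist (suc m) m (toℕ v) ⊓ cycleDist (suc m) (suc m) (toℕ v) ∎
    where
    open ≡-Reasoning
    0≡1+m : cycleDist (suc m) 0 (toℕ v) ≡ cycleDist (suc m) (suc m) (toℕ v)
    0≡1+m = trans (cycleDist-comm (suc m) 0 (toℕ v))
             (trans (sym (cycleDist-n≡cycleDist-0 (m≤n⇒m≤1+n (toℕ≤pred[n] v))))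
                    (cycleDist-comm (suc m) (toℕ v) (suc m)))

cycle-kinds-agree-outside : ∀ {m r} κ κ′ x v → x + suc r ≤ m → v ≤ x ⊎ x + suc r < v →
  keyDist (cycleDist (suc m)) (x , κ) v ⊓ suc r ≡ keyDist (cycleDist (suc m)) (x , κ′) v ⊓ suc r
cycle-kinds-agree-outside {m} {r} κ κ′ x v x+1+r≤m (inj₁ v≤x) with m≤n⇒∃[o]m+o≡n v≤x
... | d , v+d≡x = trans (truncated κ) (sym (truncated κ′))
  where
  1+r≤m∸d : suc r ≤ m ∸ d
  1+r≤m∸d = m+n≤o⇒m≤o∸n (suc r) (≤-trans (≤-reflexive (+-comm (suc r) d))
              (≤-trans (+-monoˡ-≤ (suc r) (≤-trans (m≤n+m d v) (≤-reflexive v+d≡x))) x+1+r≤m))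
  truncated : ∀ κ → keyDist (cycleDist (suc m)) (x , κ) v ⊓ suc r ≡ d ⊓ suc r
  truncated κ = trans (cong (_⊓ suc r) (cycleDist-below m κ v d v+d≡x))
                      (⊓-absorb (≤-trans 1+r≤m∸d (m∸d≤[1+m]∸d∸extent κ m d)))
cycle-kinds-agree-outside {m} {r} κ κ′ x v _ (inj₂ x+1+r<v) with beyond-window x+1+r<v
... | j , refl , 1+r≤j = trans (truncated κ) (sym (truncated κ′))
  where
  truncated : ∀ κ → keyDist (cycleDist (suc m)) (x , κ) (x + suc j) ⊓ suc r ≡ (m ∸ j) ⊓ suc r
  truncated κ = trans (cong (_⊓ suc r) (cycleDist-above m κ x j))
                      (⊓-absorb (≤-trans 1+r≤j (j≤[1+j]∸extent κ j)))

cycle-lower-bound : ∀ {m r S} → IsMixedResolving (cycleGraph (suc m)) r S → suc m ≤ suc ∣ S ∣ * suc r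
cycle-lower-bound {m} = encoded-lower-bound (cycleEncoding m) λ x x+1+r≤m v →
  cycle-kinds-agree-outside vertex edge x v x+1+r≤m

cycle-resolving : ∀ {m r} {S : Subset (suc m)} → 4 * r ≤ m → Behind S r m → Ahead S r m →
  IsMixedResolving (cycleGraph (suc m)) r S
cycle-resolving {m} 4r≤m behind ahead =
  Encoding.resolving (cycleEncoding m) (λ p q → cycle-separates 4r≤m behind ahead p q)

-- Landmark sets

∣p∪q∣≤∣p∣+∣q∣ : ∀ {n} (p q : Subset n) → ∣ p ∪ q ∣ ≤ ∣ p ∣ + ∣ q ∣
∣p∪q∣≤∣p∣+∣q∣ []          []          = z≤n
∣p∪q∣≤∣p∣+∣q∣ (true ∷ p)  (true ∷ q)  =
  s≤s (≤-trans (∣p∪q∣≤∣p∣+∣q∣ p q) (+-monoʳ-≤ ∣ p ∣ (n≤1+n ∣ q ∣)))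
∣p∪q∣≤∣p∣+∣q∣ (true ∷ p)  (false ∷ q) = s≤s (∣p∪q∣≤∣p∣+∣q∣ p q)
∣p∪q∣≤∣p∣+∣q∣ (false ∷ p) (true ∷ q)  =
  ≤-trans (s≤s (∣p∪q∣≤∣p∣+∣q∣ p q)) (≤-reflexive (sym (+-suc ∣ p ∣ ∣ q ∣)))
∣p∪q∣≤∣p∣+∣q∣ (false ∷ p) (false ∷ q) = ∣p∪q∣≤∣p∣+∣q∣ p q

module _ {n} {p q : Subset n} {x : ℕ} where

  Landmark-∪ˡ : Landmark p x → Landmark (p ∪ q) x
  Landmark-∪ˡ (v , v∈p , v≡x) = v , x∈p∪q⁺ (inj₁ v∈p) , v≡x

  Landmark-∪ʳ : Landmark q x → Landmark (p ∪ q) x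
  Landmark-∪ʳ (v , v∈q , v≡x) = v , x∈p∪q⁺ (inj₂ v∈q) , v≡x

point : ∀ {n} → ℕ → Subset n
point {n} x with x <? n
... | yes x<n = ⁅ fromℕ< x<n ⁆
... | no _    = ⊥

∣point∣≤1 : ∀ {n} x → ∣ point {n} x ∣ ≤ 1
∣point∣≤1 {n} x with x <? n
... | yes x<n = ≤-reflexive (∣⁅x⁆∣≡1 (fromℕ< x<n))
... | no _    = ≤-trans (≤-reflexive (∣⊥∣≡0 n)) z≤n

point-landmark : ∀ {n x} → x < n → Landmark (point {n} x) x
point-landmark {n} {x} x<n with x <? n
... | yes x<n′ = fromℕ< x<n′ , x∈⁅x⁆ (fromℕ< x<n′) , toℕ-fromℕ< x<n′
... | no x≮n   = ⊥-elim (x≮n x<n)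

multiples : ∀ {n} → ℕ → ℕ → Subset n
multiples r zero    = ⊥
multiples r (suc q) = point (q * r) ∪ multiples r q

∣multiples∣≤ : ∀ {n} r q → ∣ multiples {n} r q ∣ ≤ q
∣multiples∣≤ {n} r zero    = ≤-reflexive (∣⊥∣≡0 n)
∣multiples∣≤ {n} r (suc q) = ≤-trans (∣p∪q∣≤∣p∣+∣q∣ (point (q * r)) (multiples r q))
                                     (+-mono-≤ (∣point∣≤1 {n} (q * r)) (∣multiples∣≤ {n} r q))

multiples-landmark : ∀ {n r j q} → j < q → j * r < n → Landmark (multiples {n} r q) (j * r)
multiples-landmark {q = suc q} j<1+q jr<n with m≤n⇒m<n∨m≡n (s≤s⁻¹ j<1+q)
... | inj₁ j<q  = Landmark-∪ʳ (multiples-landmark j<q jr<n)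
... | inj₂ refl = Landmark-∪ˡ (point-landmark jr<n)

landmarks : ∀ m r .{{_ : NonZero r}} → Subset (suc m)
landmarks m r = point m ∪ multiples r (suc (m / r))

module _ (m r : ℕ) .{{_ : NonZero r}} where

  ∣landmarks∣≤ : ∣ landmarks m r ∣ ≤ suc (suc (m / r))
  ∣landmarks∣≤ = ≤-trans (∣p∪q∣≤∣p∣+∣q∣ (point {suc m} m) (multiples r (suc (m / r))))
                         (+-mono-≤ (∣point∣≤1 {suc m} m) (∣multiples∣≤ {suc m} r (suc (m / r))))

  landmarks-behind : Behind (landmarks m r) r m
  landmarks-behind x x≤m = x / r * r , x % r , Landmark-∪ʳ L , U+d≡x , m%n<n x r
    where
    L : Landmark (multiples {suc m} r (suc (m / r))) (x / r * r)
    L = multiples-landmark (s≤s (/-monoˡ-≤ r x≤m)) (s≤s (≤-trans (m/n*n≤m x r) x≤m))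
    U+d≡x : x / r * r + x % r ≡ x
    U+d≡x = trans (+-comm (x / r * r) (x % r)) (sym (m≡m%n+[m/n]*n x r))

  next-multiple : ∀ x → ∃ λ g → x + suc g ≡ suc (x / r) * r × g < r
  next-multiple x with m≤n⇒∃[o]m+o≡n (m%n<n x r)
  ... | g , 1+d+g≡r = g , x+1+g≡V , ≤-trans (s≤s (m≤n+m g (x % r))) (≤-reflexive 1+d+g≡r)
    where
    shape : ∀ d U g → d + U + suc g ≡ suc d + g + U
    shape = solve-∀
    x+1+g≡V : x + suc g ≡ suc (x / r) * r
    x+1+g≡V = begin
      x + suc g                       ≡⟨ cong (_+ suc g) (m≡m%n+[m/n]*n x r) ⟩
      x % r + x / r * r + suc g       ≡⟨ shape (x % r) (x / r * r) g ⟩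
      suc (x % r) + g + x / r * r     ≡⟨ cong (_+ x / r * r) 1+d+g≡r ⟩
      r + x / r * r                   ∎
      where open ≡-Reasoning

  landmarks-ahead : Ahead (landmarks m r) r m
  landmarks-ahead x x<m with next-multiple x | suc (x / r) * r ≤? m
  ... | g , x+1+g≡V , g<r | yes V≤m = g , subst (Landmark (landmarks m r)) (sym x+1+g≡V) (Landmark-∪ʳ L) , g<r
    where
    L : Landmark (multiples {suc m} r (suc (m / r))) (suc (x / r) * r)
    L = multiples-landmark (s≤s (subst (_≤ m / r) (m*n/n≡m (suc (x / r)) r) (/-monoˡ-≤ r V≤m))) (s≤s V≤m)
  ... | g , x+1+g≡V , g<r | no V≰m with m≤n⇒∃[o]m+o≡n x<m
  ...   | h , 1+x+h≡m = h , subst (Landmark (landmarks m r)) (sym x+1+h≡m) (Landmark-∪ˡ (point-landmark ≤-refl)) ,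
                        ≤-trans h<g (<⇒≤ g<r)
    where
    x+1+h≡m : x + suc h ≡ m
    x+1+h≡m = trans (+-suc x h) 1+x+h≡m
    h<g : h < g
    h<g = s≤s⁻¹ (+-cancelˡ-< x (suc h) (suc g)
            (subst₂ _<_ (sym x+1+h≡m) (sym x+1+g≡V) (≰⇒> V≰m)))

-- Existence of th_mdim

module _ {P : ℕ → Set} (P? : ∀ t → Dec (P t)) where

  private
    search : ∀ i j → (∀ s → s < i → ¬ P s) → P (i + j) →
      ∃ λ t → P t × t ≤ i + j × (∀ s → s < t → ¬ P s)
    search i zero    below p = i , subst P (+-identityʳ i) p , m≤m+n i 0 , below
    search i (suc j) below p with P? i
    ... | yes pᵢ = i , pᵢ , m≤m+n i (suc j) , below
    ... | no ¬pᵢ with search (suc i) j below′ (subst P (+-suc i j) p)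
      where
      below′ : ∀ s → s < suc i → ¬ P s
      below′ s s<1+i with m≤n⇒m<n∨m≡n (s≤s⁻¹ s<1+i)
      ... | inj₁ s<i  = below s s<i
      ... | inj₂ refl = ¬pᵢ
    ...   | t , pₜ , t≤ , below-t = t , pₜ , ≤-trans t≤ (≤-reflexive (sym (+-suc i j))) , below-t

  least-witness : ∀ t → P t → ∃ λ t′ → P t′ × t′ ≤ t × (∀ s → s < t′ → ¬ P s)
  least-witness t p = search 0 t (λ _ ()) p

module _ {n} (G : Graph n) where

  all-elem? : {P : Elem n → Set} → (∀ a → Dec (P a)) → Dec (∀ a → P a)
  all-elem? P? with all? (λ x → P? (inj₁ x)) | all? (λ u → all? (λ w → P? (inj₂ (u , w))))
  ... | yes p | yes q = yes λ { (inj₁ x) → p x ; (inj₂ (u , w)) → q u w }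
  ... | no ¬p | _     = no λ h → ¬p (λ x → h (inj₁ x))
  ... | yes _ | no ¬q = no λ h → ¬q (λ u w → h (inj₂ (u , w)))

  valid? : (a : Elem n) → Dec (ValidElem G a)
  valid? (inj₁ _)       = yes tt
  valid? (inj₂ (u , w)) = (toℕ u <? toℕ w) ×-dec (G u w Bool.≟ true)

  resolving? : ∀ r S → Dec (IsMixedResolving G r S)
  resolving? r S = all-elem? λ a → all-elem? λ b →
    valid? a →-dec (valid? b →-dec (¬? (Sum.≡-dec Fin._≟_ (Product.≡-dec Fin._≟_ Fin._≟_) a b) →-dec
      any? λ v → (v ∈? S) ×-dec ¬? (distR G r a v ≟ distR G r b v)))

  Achievable : ℕ → Set
  Achievable t = ∃₂ λ r S → IsMixedResolving G r S × r + ∣ S ∣ ≡ t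

  achievable? : ∀ t → Dec (Achievable t)
  achievable? t = map′ from to
    (any? λ (i : Fin (suc t)) → anySubset? λ S → resolving? (toℕ i) S ×-dec (toℕ i + ∣ S ∣ ≟ t))
    where
    from : (∃ λ i → ∃ λ S → IsMixedResolving G (toℕ i) S × toℕ i + ∣ S ∣ ≡ t) → Achievable t
    from (i , S , res , e) = toℕ i , S , res , e
    to : Achievable t → ∃ λ (i : Fin (suc t)) → ∃ λ S → IsMixedResolving G (toℕ i) S × toℕ i + ∣ S ∣ ≡ t
    to (r , S , res , refl) = fromℕ< r<1+t , S , subst (λ x → IsMixedResolving G x S × x + ∣ S ∣ ≡ r + ∣ S ∣)
                                (sym (toℕ-fromℕ< r<1+t)) (res , refl)
      where
      r<1+t : r < suc t
      r<1+t = s≤s (m≤m+n r ∣ S ∣)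

  thMdim-exists : ∀ r S → IsMixedResolving G r S → ∃ λ t → IsThMdim G t × t ≤ r + ∣ S ∣
  thMdim-exists r S res with least-witness achievable? (r + ∣ S ∣) (r , S , res , refl)
  ... | t , (r′ , S′ , res′ , e) , t≤ , below = t , ((r′ , S′ , res′ , e) , minimal) , t≤
    where
    minimal : ∀ r₁ S₁ → IsMixedResolving G r₁ S₁ → t ≤ r₁ + ∣ S₁ ∣
    minimal r₁ S₁ res₁ = ≮⇒≥ λ lt → below _ lt (r₁ , S₁ , res₁ , refl)

4ab≤[a+b]²-ordered : ∀ {a b} → a ≤ b → 4 * (a * b) ≤ (a + b) * (a + b)
4ab≤[a+b]²-ordered {a} a≤b with m≤n⇒∃[o]m+o≡n a≤b
... | c , refl = ≤-trans (m≤m+n _ (c * c)) (≤-reflexive (square-split a c))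
  where
  square-split : ∀ a c → 4 * (a * (a + c)) + c * c ≡ (a + (a + c)) * (a + (a + c))
  square-split = solve-∀

4ab≤[a+b]² : ∀ a b → 4 * (a * b) ≤ (a + b) * (a + b)
4ab≤[a+b]² a b with ≤-total a b
... | inj₁ a≤b = 4ab≤[a+b]²-ordered a≤b
... | inj₂ b≤a = subst₂ _≤_ (cong (4 *_) (*-comm b a)) (cong (λ x → x * x) (+-comm b a))
                           (4ab≤[a+b]²-ordered b≤a)

square-cancel : ∀ {x y} → x * x ≤ y * y → x ≤ y
square-cancel {x} {y} x²≤y² with x ≤? y
... | yes x≤y = x≤y
... | no x≰y  = ⊥-elim (<⇒≱ (*-mono-< (≰⇒> x≰y) (≰⇒> x≰y)) x²≤y²)

square-mono : ∀ {x y} → x ≤ y → x * x ≤ y * y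
square-mono x≤y = *-mono-≤ x≤y x≤y

square-cancel-< : ∀ {x y} → x * x < y * y → x < y
square-cancel-< {x} {y} x²<y² = ≰⇒> λ y≤x → <⇒≱ x²<y² (square-mono y≤x)

integer-sqrt : ∀ n → ∃ λ s → s * s ≤ n × n < suc s * suc s
integer-sqrt zero = 0 , z≤n , s≤s z≤n
integer-sqrt (suc n) with integer-sqrt n
... | s , s²≤n , n<[1+s]² with suc s * suc s ≤? suc n
...   | yes [1+s]²≤1+n = suc s , [1+s]²≤1+n , ≤-trans (s≤s n<[1+s]²) (*-mono-< (n<1+n (suc s)) (n<1+n (suc s)))
...   | no [1+s]²≰1+n  = s , m≤n⇒m≤1+n s²≤n , ≰⇒> [1+s]²≰1+n

4n≤[t+2]² : ∀ {n} a b {t} → n ≤ suc a * suc b → b + a ≡ t → 4 * n ≤ (t + 2) * (t + 2)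
4n≤[t+2]² {n} a b n≤ refl = begin
  4 * n                               ≤⟨ *-monoʳ-≤ 4 n≤ ⟩
  4 * (suc a * suc b)                 ≤⟨ 4ab≤[a+b]² (suc a) (suc b) ⟩
  (suc a + suc b) * (suc a + suc b)   ≡⟨ shape a b ⟩
  (b + a + 2) * (b + a + 2)           ∎
  where
  open ≤-Reasoning
  shape : ∀ a b → (suc a + suc b) * (suc a + suc b) ≡ (b + a + 2) * (b + a + 2)
  shape = solve-∀

lower-within : ∀ k′ s t n → 2 * k′ + 1 ≤ s → s * s ≤ n → n ≤ suc s * suc s → 4 * n ≤ (t + 2) * (t + 2) →
  4 * n * (k′ * k′) ≤ (suc k′ * suc k′) * (t * t)
lower-within k′ s t n 2k′+1≤s s²≤n n≤[1+s]² 4n≤[t+2]² = begin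
  4 * n * (k′ * k′)                   ≤⟨ *-monoˡ-≤ (k′ * k′) (*-monoʳ-≤ 4 n≤[1+s]²) ⟩
  4 * (suc s * suc s) * (k′ * k′)     ≡⟨ square₁ s k′ ⟩
  (2 * suc s * k′) * (2 * suc s * k′) ≤⟨ square-mono key ⟩
  (suc k′ * t) * (suc k′ * t)         ≡⟨ square₂ k′ t ⟩
  (suc k′ * suc k′) * (t * t)         ∎
  where
  open ≤-Reasoning
  square₁ : ∀ s k′ → 4 * (suc s * suc s) * (k′ * k′) ≡ (2 * suc s * k′) * (2 * suc s * k′)
  square₁ = solve-∀
  square₂ : ∀ k′ t → (suc k′ * t) * (suc k′ * t) ≡ (suc k′ * suc k′) * (t * t)
  square₂ = solve-∀
  2s≤t+2 : 2 * s ≤ t + 2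
  2s≤t+2 = square-cancel (begin
    (2 * s) * (2 * s) ≡⟨ square₃ s ⟩
    4 * (s * s)       ≤⟨ *-monoʳ-≤ 4 s²≤n ⟩
    4 * n             ≤⟨ 4n≤[t+2]² ⟩
    (t + 2) * (t + 2) ∎)
    where
    square₃ : ∀ s → (2 * s) * (2 * s) ≡ 4 * (s * s)
    square₃ = solve-∀
  key : 2 * suc s * k′ ≤ suc k′ * t
  key = +-cancelʳ-≤ (2 * suc k′) (2 * suc s * k′) (suc k′ * t) (begin
    2 * suc s * k′ + 2 * suc k′   ≡⟨ shape₁ s k′ ⟩
    2 * s * k′ + 2 * (2 * k′ + 1) ≤⟨ +-monoʳ-≤ (2 * s * k′) (*-monoʳ-≤ 2 2k′+1≤s) ⟩
    2 * s * k′ + 2 * s            ≡⟨ shape₂ s k′ ⟩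
    suc k′ * (2 * s)              ≤⟨ *-monoʳ-≤ (suc k′) 2s≤t+2 ⟩
    suc k′ * (t + 2)              ≡⟨ shape₃ k′ t ⟩
    suc k′ * t + 2 * suc k′       ∎)
    where
    shape₁ : ∀ s k′ → 2 * suc s * k′ + 2 * suc k′ ≡ 2 * s * k′ + 2 * (2 * k′ + 1)
    shape₁ = solve-∀
    shape₂ : ∀ s k′ → 2 * s * k′ + 2 * s ≡ suc k′ * (2 * s)
    shape₂ = solve-∀
    shape₃ : ∀ k′ t → suc k′ * (t + 2) ≡ suc k′ * t + 2 * suc k′
    shape₃ = solve-∀

upper-within : ∀ k s t n → 2 * k ≤ s → s * s ≤ n → t ≤ 2 * s + 4 →
  (k * k) * (t * t) ≤ 4 * n * ((k + 1) * (k + 1))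
upper-within k s t n 2k≤s s²≤n t≤2s+4 = begin
  (k * k) * (t * t)                   ≡⟨ square₁ k t ⟩
  (k * t) * (k * t)                   ≤⟨ square-mono key ⟩
  (2 * s * (k + 1)) * (2 * s * (k + 1)) ≡⟨ square₂ s k ⟩
  4 * (s * s) * ((k + 1) * (k + 1))   ≤⟨ *-monoˡ-≤ ((k + 1) * (k + 1)) (*-monoʳ-≤ 4 s²≤n) ⟩
  4 * n * ((k + 1) * (k + 1))         ∎
  where
  open ≤-Reasoning
  square₁ : ∀ k t → (k * k) * (t * t) ≡ (k * t) * (k * t)
  square₁ = solve-∀
  square₂ : ∀ s k → (2 * s * (k + 1)) * (2 * s * (k + 1)) ≡ 4 * (s * s) * ((k + 1) * (k + 1))
  square₂ = solve-∀
  key : k * t ≤ 2 * s * (k + 1)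
  key = begin
    k * t                       ≤⟨ *-monoʳ-≤ k t≤2s+4 ⟩
    k * (2 * s + 4)             ≡⟨ shape₁ k s ⟩
    k * (2 * s) + 2 * (2 * k)   ≤⟨ +-monoʳ-≤ (k * (2 * s)) (*-monoʳ-≤ 2 2k≤s) ⟩
    k * (2 * s) + 2 * s         ≡⟨ shape₂ k s ⟩
    2 * s * (k + 1)             ∎
    where
    shape₁ : ∀ k s → k * (2 * s + 4) ≡ k * (2 * s) + 2 * (2 * k)
    shape₁ = solve-∀
    shape₂ : ∀ k s → k * (2 * s) + 2 * s ≡ 2 * s * (k + 1)
    shape₂ = solve-∀

module _ (k′ m s : ℕ) .{{_ : NonZero s}} (s²≤n : s * s ≤ suc m) (n<[1+s]² : suc m < suc s * suc s)
         (2k+5≤s : 2 * suc k′ + 5 ≤ s) where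

  ∣landmarks∣≤s+4 : ∣ landmarks m s ∣ ≤ s + 4
  ∣landmarks∣≤s+4 = ≤-trans (∣landmarks∣≤ m s) (≤-trans (s≤s (s≤s m/s≤s+2)) (≤-reflexive (shape′ s)))
    where
    shape′ : ∀ s → suc (suc (s + 2)) ≡ s + 4
    shape′ = solve-∀
    shape : ∀ s → suc s * suc s ≡ suc ((s + 2) * s)
    shape = solve-∀
    m/s≤s+2 : m / s ≤ s + 2
    m/s≤s+2 = subst (m / s ≤_) (m*n/n≡m (s + 2) s)
                (/-monoˡ-≤ s (≤-trans (n≤1+n m) (s≤s⁻¹ (≤-trans n<[1+s]² (≤-reflexive (shape s))))))

  4s≤m : 4 * s ≤ m
  4s≤m = s≤s⁻¹ (begin
    suc (4 * s) ≤⟨ +-monoˡ-≤ (4 * s) (≤-trans (s≤s z≤n) 5≤s) ⟩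
    5 * s       ≤⟨ *-monoˡ-≤ s 5≤s ⟩
    s * s       ≤⟨ s²≤n ⟩
    suc m       ∎)
    where
    open ≤-Reasoning
    5≤s : 5 ≤ s
    5≤s = ≤-trans (m≤n+m 5 (2 * suc k′)) 2k+5≤s

  thMdim-within : (G : Graph (suc m)) → (∀ {r S} → IsMixedResolving G r S → suc m ≤ suc ∣ S ∣ * suc r) →
    IsMixedResolving G s (landmarks m s) → Σ ℕ λ t → IsThMdim G t × WithinFactor (suc k′) (suc m) t
  thMdim-within G lower-bound resolving = estimate (thMdim-exists G s (landmarks m s) resolving)
    where
    estimate : (∃ λ t → IsThMdim G t × t ≤ s + ∣ landmarks m s ∣) →
      Σ ℕ λ t → IsThMdim G t × WithinFactor (suc k′) (suc m) t
    estimate (t , th@((r₀ , S₀ , resolving₀ , r₀+∣S₀∣≡t) , _) , t≤s+∣S∣) =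
      t , th , lower-within k′ s t (suc m) 2k′+1≤s s²≤n (<⇒≤ n<[1+s]²)
                 (4n≤[t+2]² ∣ S₀ ∣ r₀ (lower-bound resolving₀) r₀+∣S₀∣≡t) ,
               upper-within (suc k′) s t (suc m) (≤-trans (m≤m+n (2 * suc k′) 5) 2k+5≤s) s²≤n t≤2s+4
      where
      t≤2s+4 : t ≤ 2 * s + 4
      t≤2s+4 = ≤-trans t≤s+∣S∣ (≤-trans (+-monoʳ-≤ s ∣landmarks∣≤s+4) (≤-reflexive (shape s)))
        where
        shape : ∀ s → s + (s + 4) ≡ 2 * s + 4
        shape = solve-∀
      2k′+1≤s : 2 * k′ + 1 ≤ s
      2k′+1≤s = ≤-trans (≤-trans (m≤m+n (2 * k′ + 1) 6) (≤-reflexive (shape k′))) 2k+5≤s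
        where
        shape : ∀ k′ → 2 * k′ + 1 + 6 ≡ 2 * suc k′ + 5
        shape = solve-∀

thMdim-bounds : ∀ k′ m s → s * s ≤ suc m → suc m < suc s * suc s →
  (2 * suc k′ + 5) * (2 * suc k′ + 5) ≤ suc m →
  (Σ ℕ λ t → IsThMdim (cycleGraph (suc m)) t × WithinFactor (suc k′) (suc m) t) ×
  (Σ ℕ λ t → IsThMdim (pathGraph (suc m)) t × WithinFactor (suc k′) (suc m) t)
thMdim-bounds k′ m zero    _    (s≤s ())  _
thMdim-bounds k′ m s@(suc _) s²≤n n<[1+s]² c²≤n =
  thMdim-within k′ m s s²≤n n<[1+s]² c≤s (cycleGraph (suc m)) cycle-lower-bound
    (cycle-resolving (4s≤m k′ m s s²≤n n<[1+s]² c≤s) (landmarks-behind m s) (landmarks-ahead m s)) ,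
  thMdim-within k′ m s s²≤n n<[1+s]² c≤s (pathGraph (suc m)) path-lower-bound
    (path-resolving (landmarks-behind m s) (landmarks-ahead m s))
  where
  c≤s : 2 * suc k′ + 5 ≤ s
  c≤s = s≤s⁻¹ (square-cancel-< (≤-<-trans c²≤n n<[1+s]²))

mainTheorem19 :
    (k : ℕ) → 1 ≤ k → Σ ℕ λ N → (n : ℕ) → 3 ≤ n → N ≤ n →
      (Σ ℕ λ t → IsThMdim (cycleGraph n) t × WithinFactor k n t) ×
      (Σ ℕ λ t → IsThMdim (pathGraph n) t × WithinFactor k n t)
mainTheorem19 (suc k′) _ = (2 * suc k′ + 5) * (2 * suc k′ + 5) , λ where
  (suc m) _ c²≤n → let s , s²≤n , n<[1+s]² = integer-sqrt (suc m)
                   in thMdim-bounds k′ m s s²≤n n<[1+s]² c²≤n
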